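{- Let $\Gamma\cup\{\varphi\}$ be a set of formulas of the first-order language $\mathfrak{Fm}_\Theta$ over a signature $\Theta$. Then $\Gamma\vdash\varphi$ in QN4 if and only if $\Gamma\vDash\varphi$.
   Context: A first-order signature $\Theta=\langle\mathcal{P},\mathcal{F}\rangle$ consists of predicate symbols $\mathcal{P}\neq\emptyset$ and function symbols $\mathcal{F}$; formulas are built from connectives $\vee,\wedge,\to,\neg$ ($\neg$ a strong, paraconsistent negation), $\bot$, quantifiers $\forall,\exists$ and a countable set $Var$ of variables; $\alpha\leftrightarrow\beta$ abbreviates $(\alpha\to\beta)\wedge(\beta\to\alpha)$. QN4 is the Hilbert calculus with axiom schemas: (N1) $\alpha\to(\beta\to\alpha)$; (N2) $(\alpha\to(\beta\to\gamma))\to((\alpha\to\beta)\to(\alpha\to\gamma))$; (N3) $(\alpha\wedge\beta)\to\beta$; (N4) $(\alpha\wedge\beta)\to\alpha$; (N5) $\alpha\to(\beta\to(\alpha\wedge\beta))$; (N6) $\alpha\to(\alpha\vee\beta)$; (N7) $\beta\to(\alpha\vee\beta)$; (N8) $(\alpha\to\gamma)\to((\beta\to\gamma)\to((\alpha\vee\beta)\to\gamma))$; (N9) $\neg(\alpha\to\beta)\leftrightarrow\alpha\wedge\neg\beta$; (N10) $\neg(\alpha\wedge\beta)\leftrightarrow\neg\alpha\vee\neg\beta$; (N11) $\neg(\alpha\vee\beta)\leftrightarrow\neg\alpha\wedge\neg\beta$; (N12)/(N13) $\neg\neg\alpha\leftrightarrow\alpha$; (A1) $\varphi(x/t)\to\exists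 x\varphi$ and (A2) $\forall x\varphi\to\varphi(x/t)$ for $t$ free for $x$ in $\varphi$; and rules: modus ponens; from $\alpha\to\beta$ infer $\exists x\alpha\to\beta$ if $x$ is not free in $\beta$; from $\alpha\to\beta$ infer $\alpha\to\forall x\beta$ if $x$ is not free in $\alpha$. $\Gamma\vdash\varphi$ means $\varphi$ is derivable from $\Gamma$. An N4-structure is $\langle A,\{N_x\}_{x\in A}\rangle$ where $A$ is a generalized Heyting algebra (a distributive lattice with top $1$ and an operation $\to$ with $x\wedge y\leq z$ iff $x\leq y\to z$) and each $N_x\subseteq A$ with: (i) $N_x\neq\emptyset$; (ii) for $x'\in N_x$, $y'\in N_y$: $x'\vee y'\in N_{x\wedge y}$, $x'\wedge y'\in N_{x\vee y}$, and $x\in N_{x'}$; (iii) for $y'\in N_y$: $x\wedge y'\in N_{x\to y}$. A $\Theta$-structure $\mathfrak{A}=(\langle A,\{N_x\}\rangle,\mathbf{S})$ consists of an N4-structure with $A$ a complete lattice and $\mathbf{S}=\langle S,\{P_{\mathbf S}\},\{f_{\mathbf S}\}\rangle$ with $S\neq\emptyset$, $P_{\mathbf S}:S^n\to A$ for each $n$-ary $P\in\mathcal{P}$, and $f_{\mathbf S}:S^n\to S$ for each $n$-ary $f\in\mathcal F$. A valuation is $v:Var\to S$; $v[x\to a]$ agrees with $v$ except sending $x$ to $a$. Truth values $\|\cdot\|_v$ (given with the structure) satisfy: $\|x\|_v=v(x)$; $\|f(t_1,\dots,t_n)\|_v=f_{\mathbf S}(\|t_1\|_v,\dots,\|t_n\|_v)$;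 $\|P(t_1,\dots,t_n)\|_v=P_{\mathbf S}(\|t_1\|_v,\dots,\|t_n\|_v)$; $\|\varphi\#\psi\|_v=\|\varphi\|_v\#\|\psi\|_v$ for $\#\in\{\wedge,\vee,\to\}$; $\|\neg\alpha\|_v\in N_{\|\alpha\|_v}$ and $\|\neg\neg\alpha\|_v=\|\alpha\|_v$; $\|\neg(\alpha\vee\beta)\|_v=\|\neg\alpha\|_v\wedge\|\neg\beta\|_v$; $\|\neg(\alpha\wedge\beta)\|_v=\|\neg\alpha\|_v\vee\|\neg\beta\|_v$; $\|\neg(\alpha\to\beta)\|_v=\|\alpha\|_v\wedge\|\neg\beta\|_v$; $\|\forall x\alpha\|_v=\bigwedge_{a\in S}\|\alpha\|_{v[x\to a]}$; $\|\exists x\alpha\|_v=\bigvee_{a\in S}\|\alpha\|_{v[x\to a]}$; $\|\alpha(x/t)\|_v=\|\alpha\|_{v[x\to\|t\|_v]}$ if $t$ is free for $x$ in $\alpha$. $\mathfrak A\vDash\varphi$ means $\|\varphi\|_v=1$ for every valuation $v$; $\Gamma\vDash\varphi$ means every $\mathfrak A$ with $\mathfrak A\vDash\gamma$ for all $\gamma\in\Gamma$ satisfies $\mathfrak A\vDash\varphi$. -}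

module Defs where

open import Level using (Level; _⊔_) renaming (suc to lsuc; zero to lzero)
open import Data.Nat using (ℕ; _≟_)
open import Data.Bool using (Bool; true; false; _∨_; _∧_; not; if_then_else_)
open import Data.Vec using (Vec; []; _∷_)
open import Data.Product using (_×_; _,_; Σ)
open import Data.Unit using (⊤)
open import Data.Sum using (_⊎_)
open import Data.Empty using (⊥)
open import Relation.Nullary.Decidable using (⌊_⌋)
open import Relation.Binary.Core using (Rel)
open import Relation.Binary.PropositionalEquality using (_≡_)
open import Relation.Binary.Lattice using (IsDistributiveLattice; Exponential)
open import Relation.Binary.Definitions using (Maximum)
open import Function.Bundles using (_⇔_)

record Signature : Set₁ where
  field
    PredSym   : Set
    predArity : PredSym → ℕ
    FunSym    : Set
    funArity  : FunSym → ℕ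
    somePred  : PredSym

open Signature public

Var : Set
Var = ℕ

_==_ : Var → Var → Bool
x == y = ⌊ x ≟ y ⌋

data Term (Θ : Signature) : Set where
  var : Var → Term Θ
  app : (f : FunSym Θ) → Vec (Term Θ) (funArity Θ f) → Term Θ

infixr 6 _∧'_
infixr 5 _∨'_
infixr 4 _⇒_

data Fm (Θ : Signature) : Set where
  atom : (P : PredSym Θ) → Vec (Term Θ) (predArity Θ P) → Fm Θ
  ⊥'   : Fm Θ
  _∧'_ : Fm Θ → Fm Θ → Fm Θ
  _∨'_ : Fm Θ → Fm Θ → Fm Θ
  _⇒_  : Fm Θ → Fm Θ → Fm Θ
  ¬'_  : Fm Θ → Fm Θ
  ∀'   : Var → Fm Θ → Fm Θ
  ∃'   : Var → Fm Θ → Fm Θ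

_⇔'_ : {Θ : Signature} → Fm Θ → Fm Θ → Fm Θ
α ⇔' β = (α ⇒ β) ∧' (β ⇒ α)

module _ {Θ : Signature} where

  occT  : Var → Term Θ → Bool
  occTs : ∀ {n} → Var → Vec (Term Θ) n → Bool
  occT x (var y)    = x == y
  occT x (app f ts) = occTs x ts
  occTs x []       = false
  occTs x (t ∷ ts) = occT x t ∨ occTs x ts

  free : Var → Fm Θ → Bool
  free x (atom P ts) = occTs x ts
  free x ⊥'          = false
  free x (α ∧' β)    = free x α ∨ free x β
  free x (α ∨' β)    = free x α ∨ free x β
  free x (α ⇒ β)     = free x α ∨ free x β
  free x (¬' α)      = free x α
  free x (∀' y α)    = not (x == y) ∧ free x α
  free x (∃' y α)    = not (x == y) ∧ free x α

  substT  : Term Θ → Var → Term Θ → Term Θ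
  substTs : ∀ {n} → Term Θ → Var → Vec (Term Θ) n → Vec (Term Θ) n
  substT t x (var y)    = if x == y then t else var y
  substT t x (app f ts) = app f (substTs t x ts)
  substTs t x []       = []
  substTs t x (s ∷ ss) = substT t x s ∷ substTs t x ss

  _[_/_] : Fm Θ → Var → Term Θ → Fm Θ
  atom P ts [ x / t ] = atom P (substTs t x ts)
  ⊥'        [ x / t ] = ⊥'
  (α ∧' β)  [ x / t ] = (α [ x / t ]) ∧' (β [ x / t ])
  (α ∨' β)  [ x / t ] = (α [ x / t ]) ∨' (β [ x / t ])
  (α ⇒ β)   [ x / t ] = (α [ x / t ]) ⇒ (β [ x / t ])
  (¬' α)    [ x / t ] = ¬' (α [ x / t ])
  ∀' y α    [ x / t ] = if x == y then ∀' y α else ∀' y (α [ x / t ])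
  ∃' y α    [ x / t ] = if x == y then ∃' y α else ∃' y (α [ x / t ])

  FreeFor : Term Θ → Var → Fm Θ → Set
  FreeFor t x (atom P ts) = ⊤
  FreeFor t x ⊥'          = ⊤
  FreeFor t x (α ∧' β)    = FreeFor t x α × FreeFor t x β
  FreeFor t x (α ∨' β)    = FreeFor t x α × FreeFor t x β
  FreeFor t x (α ⇒ β)     = FreeFor t x α × FreeFor t x β
  FreeFor t x (¬' α)      = FreeFor t x α
  FreeFor t x (∀' y α)    = (free x (∀' y α) ≡ false) ⊎ (occT y t ≡ false × FreeFor t x α)
  FreeFor t x (∃' y α)    = (free x (∃' y α) ≡ false) ⊎ (occT y t ≡ false × FreeFor t x α)

infix 2 _⊢_

data _⊢_ {Θ : Signature} (Γ : Fm Θ → Set) : Fm Θ → Set where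
  hyp : ∀ {φ} → Γ φ → Γ ⊢ φ
  N1  : ∀ α β → Γ ⊢ α ⇒ (β ⇒ α)
  N2  : ∀ α β γ → Γ ⊢ (α ⇒ (β ⇒ γ)) ⇒ ((α ⇒ β) ⇒ (α ⇒ γ))
  N3  : ∀ α β → Γ ⊢ (α ∧' β) ⇒ β
  N4  : ∀ α β → Γ ⊢ (α ∧' β) ⇒ α
  N5  : ∀ α β → Γ ⊢ α ⇒ (β ⇒ (α ∧' β))
  N6  : ∀ α β → Γ ⊢ α ⇒ (α ∨' β)
  N7  : ∀ α β → Γ ⊢ β ⇒ (α ∨' β)
  N8  : ∀ α β γ → Γ ⊢ (α ⇒ γ) ⇒ ((β ⇒ γ) ⇒ ((α ∨' β) ⇒ γ))
  N9  : ∀ α β → Γ ⊢ (¬' (α ⇒ β)) ⇔' (α ∧' ¬' β)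
  N10 : ∀ α β → Γ ⊢ (¬' (α ∧' β)) ⇔' (¬' α ∨' ¬' β)
  N11 : ∀ α β → Γ ⊢ (¬' (α ∨' β)) ⇔' (¬' α ∧' ¬' β)
  N12 : ∀ α → Γ ⊢ (¬' (¬' α)) ⇔' α
  A1  : ∀ φ x t → FreeFor t x φ → Γ ⊢ (φ [ x / t ]) ⇒ ∃' x φ
  A2  : ∀ φ x t → FreeFor t x φ → Γ ⊢ ∀' x φ ⇒ (φ [ x / t ])
  MP  : ∀ {α β} → Γ ⊢ α → Γ ⊢ α ⇒ β → Γ ⊢ β
  R∃  : ∀ {α β} x → free x β ≡ false → Γ ⊢ α ⇒ β → Γ ⊢ ∃' x α ⇒ β
  R∀  : ∀ {α β} x → free x α ≡ false → Γ ⊢ α ⇒ β → Γ ⊢ α ⇒ ∀' x β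

-- Semantics.
-- Equality in the algebra is a setoid equality _≈_ (stdlib convention);
-- the order _≤_ is a partial order w.r.t. _≈_.

-- A complete generalized Heyting algebra: a distributive lattice with a
-- top element 1 and a relative pseudocomplement ⇨ (x ∧ y ≤ z iff
-- x ≤ y ⇨ z), complete w.r.t. families indexed by types in Set s.
record CompleteGHA (c ℓ s : Level) : Set (lsuc (c ⊔ ℓ ⊔ s)) where
  infixr 6 _⊓_
  infixr 5 _⊔'_
  infixr 4 _⇨_
  field
    Carrier : Set c
    _≈_     : Rel Carrier ℓ
    _≤_     : Rel Carrier ℓ
    _⊔'_    : Carrier → Carrier → Carrier
    _⊓_     : Carrier → Carrier → Carrier
    _⇨_     : Carrier → Carrier → Carrier
    𝟏       : Carrier
    isDistributiveLattice : IsDistributiveLattice _≈_ _≤_ _⊔'_ _⊓_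
    maximum     : Maximum _≤_ 𝟏
    exponential : Exponential _≤_ _⊓_ _⇨_
    ⋀ : {I : Set s} → (I → Carrier) → Carrier
    ⋁ : {I : Set s} → (I → Carrier) → Carrier
    ⋀-lower    : ∀ {I : Set s} (f : I → Carrier) i → ⋀ f ≤ f i
    ⋀-greatest : ∀ {I : Set s} (f : I → Carrier) z → (∀ i → z ≤ f i) → z ≤ ⋀ f
    ⋁-upper    : ∀ {I : Set s} (f : I → Carrier) i → f i ≤ ⋁ f
    ⋁-least    : ∀ {I : Set s} (f : I → Carrier) z → (∀ i → f i ≤ z) → ⋁ f ≤ z

-- An N4-structure ⟨A, {N_x}⟩ with A complete.  `N x y` means y ∈ N_x.
record CompleteN4Structure (c ℓ s : Level) : Set (lsuc (c ⊔ ℓ ⊔ s)) where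
  field
    A : CompleteGHA c ℓ s
  open CompleteGHA A public
  field
    N     : Carrier → Carrier → Set ℓ
    -- each N_x is a subset of the setoid A (closed under ≈, in both x and y)
    N-resp : ∀ {x x' y y'} → x ≈ x' → y ≈ y' → N x y → N x' y'
    N-nonempty : ∀ x → Σ Carrier (N x)
    N-∧ : ∀ {x y x' y'} → N x x' → N y y' → N (x ⊓ y) (x' ⊔' y')
    N-∨ : ∀ {x y x' y'} → N x x' → N y y' → N (x ⊔' y) (x' ⊓ y')
    N-inv : ∀ {x x'} → N x x' → N x' x
    N-⇨ : ∀ {x y y'} → N y y' → N (x ⇨ y) (x ⊓ y')

module _ {Θ : Signature} where

  module TermEval {s} (S : Set s)
                  (fS : (f : FunSym Θ) → Vec S (funArity Θ f) → S) where
    evalT  : (Var → S) → Term Θ → S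
    evalTs : ∀ {n} → (Var → S) → Vec (Term Θ) n → Vec S n
    evalT v (var x)    = v x
    evalT v (app f ts) = fS f (evalTs v ts)
    evalTs v []       = []
    evalTs v (t ∷ ts) = evalT v t ∷ evalTs v ts

  update : ∀ {s} {S : Set s} → (Var → S) → Var → S → (Var → S)
  update v x a y = if y == x then a else v y

  -- A Θ-structure 𝔄 = (⟨A,{N_x}⟩, 𝐒) together with its truth-value
  -- function ‖·‖ satisfying the clauses of the definition.
  record ThetaStructure (c ℓ s : Level) : Set (lsuc (c ⊔ ℓ ⊔ s)) where
    field
      n4 : CompleteN4Structure c ℓ s
    open CompleteN4Structure n4 public
    field
      S  : Set s
      S-nonempty : S
      PS : (P : PredSym Θ) → Vec S (predArity Θ P) → Carrier
      fS : (f : FunSym Θ) → Vec S (funArity Θ f) → S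
    open TermEval S fS public
    field
      ‖_‖ : Fm Θ → (Var → S) → Carrier
      -- valuations are functions, so pointwise-equal valuations are equal
      ‖‖-ext : ∀ φ v w → (∀ x → v x ≡ w x) → ‖ φ ‖ v ≈ ‖ φ ‖ w
      ‖atom‖ : ∀ P ts v → ‖ atom P ts ‖ v ≈ PS P (evalTs v ts)
      ‖∧‖ : ∀ α β v → ‖ α ∧' β ‖ v ≈ (‖ α ‖ v ⊓ ‖ β ‖ v)
      ‖∨‖ : ∀ α β v → ‖ α ∨' β ‖ v ≈ (‖ α ‖ v ⊔' ‖ β ‖ v)
      ‖⇒‖ : ∀ α β v → ‖ α ⇒ β ‖ v ≈ (‖ α ‖ v ⇨ ‖ β ‖ v)
      ‖¬‖ : ∀ α v → N (‖ α ‖ v) (‖ ¬' α ‖ v)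
      ‖¬¬‖ : ∀ α v → ‖ ¬' (¬' α) ‖ v ≈ ‖ α ‖ v
      ‖¬∨‖ : ∀ α β v → ‖ ¬' (α ∨' β) ‖ v ≈ (‖ ¬' α ‖ v ⊓ ‖ ¬' β ‖ v)
      ‖¬∧‖ : ∀ α β v → ‖ ¬' (α ∧' β) ‖ v ≈ (‖ ¬' α ‖ v ⊔' ‖ ¬' β ‖ v)
      ‖¬⇒‖ : ∀ α β v → ‖ ¬' (α ⇒ β) ‖ v ≈ (‖ α ‖ v ⊓ ‖ ¬' β ‖ v)
      ‖∀‖ : ∀ x α v → ‖ ∀' x α ‖ v ≈ ⋀ (λ (a : S) → ‖ α ‖ (update v x a))
      ‖∃‖ : ∀ x α v → ‖ ∃' x α ‖ v ≈ ⋁ (λ (a : S) → ‖ α ‖ (update v x a))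
      ‖subst‖ : ∀ α x t v → FreeFor t x α →
                ‖ α [ x / t ] ‖ v ≈ ‖ α ‖ (update v x (evalT v t))

  _⊨ₛ_ : ∀ {c ℓ s} → ThetaStructure c ℓ s → Fm Θ → Set (ℓ ⊔ s)
  𝔄 ⊨ₛ φ = ∀ (v : Var → S) → ‖ φ ‖ v ≈ 𝟏
    where open ThetaStructure 𝔄

  ⊨[_,_,_] : ∀ c ℓ s → (Fm Θ → Set) → Fm Θ → Set (lsuc (c ⊔ ℓ ⊔ s))
  ⊨[ c , ℓ , s ] Γ φ =
    (𝔄 : ThetaStructure c ℓ s) → (∀ γ → Γ γ → 𝔄 ⊨ₛ γ) → 𝔄 ⊨ₛ φ

  infix 2 _⊨_
  _⊨_ : (Fm Θ → Set) → Fm Θ → Set₂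
  Γ ⊨ φ = ⊨[ lsuc lzero , lsuc lzero , lzero ] Γ φ

{-# OPTIONS --safe #-}
-- For completeness, the
-- signature is extended by countably many parameters (nullary function
-- symbols) and Γ is read over the extension as Γ⁺.  The canonical structure
-- has the closed terms as domain and, as truth values, the Dedekind–MacNeille
-- completion of the Lindenbaum algebra of Γ⁺; a formula under a valuation is
-- sent to the principal ideal of its closed instance.  The completion keeps
-- every existing meet and join, so the quantifier clauses amount to ∀x β
-- (∃x β) being the infimum (supremum) of its closed instances, which holds
-- because a derivation of d ⇒ β(p) for a fresh parameter p becomes, after
-- renaming p into a fresh variable, a premise of R∀.  If Γ ⊨ φ, the
-- universal closure of φ is then derivable from Γ⁺, and mapping all
-- parameters to one fresh variable turns that derivation into one from Γ.

module Submission where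

open import Defs
open import Level using (Lift; lift) renaming (suc to lsuc; zero to lzero)
open import Data.Nat using (ℕ; zero; suc; _<_; _⊔_; _≟_; _≤?_; s≤s)
open import Data.Nat.Properties
  using (m≤m⊔n; m≤n⊔m; m⊔n<o⇒m<o; m⊔n<o⇒n<o; n<1+n; <⇒≢; >⇒≢; m<1+n⇒m<n∨m≡n; ≰⇒>)
open import Data.Bool using (true; false; not; _∨_; _∧_; if_then_else_)
open import Data.Vec using (Vec; []; _∷_)
open import Data.Product using (Σ; _×_; _,_; proj₁; proj₂)
open import Data.Sum using (_⊎_; inj₁; inj₂; [_,_]′)
open import Data.Empty using (⊥; ⊥-elim)
open import Data.Unit using (⊤; tt)
open import Function.Base using (_∘_; case_of_)
open import Function.Bundles using (_⇔_; mk⇔)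
open import Relation.Binary.PropositionalEquality
open import Relation.Binary.Lattice using (IsDistributiveLattice)
open import Relation.Nullary using (¬_; yes; no)
open import Relation.Nullary.Reflects using (Reflects; ofʸ; ofⁿ; invert)
open import Relation.Nullary.Decidable using (proof; isYes≗does; dec-true; dec-false)

-- Variables and substitution

==-reflects : ∀ x y → Reflects (x ≡ y) (x == y)
==-reflects x y = subst (Reflects (x ≡ y)) (sym (isYes≗does (x ≟ y))) (proof (x ≟ y))

==⇒≡ : ∀ {x y} → (x == y) ≡ true → x ≡ y
==⇒≡ {x} {y} e = invert (subst (Reflects (x ≡ y)) e (==-reflects x y))

==-false⇒≢ : ∀ {x y} → (x == y) ≡ false → x ≢ y
==-false⇒≢ {x} {y} e = invert (subst (Reflects (x ≡ y)) e (==-reflects x y))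

==-refl : ∀ x → (x == x) ≡ true
==-refl x = trans (isYes≗does (x ≟ x)) (dec-true (x ≟ x) refl)

≢⇒==-false : ∀ {x y} → x ≢ y → (x == y) ≡ false
≢⇒==-false {x} {y} x≢y = trans (isYes≗does (x ≟ y)) (dec-false (x ≟ y) x≢y)

==-sym : ∀ x y → (x == y) ≡ (y == x)
==-sym x y with x == y | ==-reflects x y | y == x | ==-reflects y x
... | true  | _     | true  | _     = refl
... | false | _     | false | _     = refl
... | true  | ofʸ p | false | ofⁿ q = ⊥-elim (q (sym p))
... | false | ofⁿ p | true  | ofʸ q = ⊥-elim (p (sym q))

∨-false⁻ : ∀ {a b} → a ∨ b ≡ false → a ≡ false × b ≡ false
∨-false⁻ {false} {false} _ = refl , refl

∨-false : ∀ {a b} → a ≡ false → b ≡ false → a ∨ b ≡ false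
∨-false refl refl = refl

∨-trueˡ : ∀ {a} b → a ≡ true → a ∨ b ≡ true
∨-trueˡ _ refl = refl

∨-trueʳ : ∀ a {b} → b ≡ true → a ∨ b ≡ true
∨-trueʳ true  _ = refl
∨-trueʳ false e = e

not-true-∧ : ∀ {a} b → a ≡ true → not a ∧ b ≡ false
not-true-∧ _ refl = refl

not-false-∧ : ∀ {a} b → a ≡ false → not a ∧ b ≡ b
not-false-∧ _ refl = refl

not-∧-true⁻ : ∀ {a b} → not a ∧ b ≡ true → a ≡ false × b ≡ true
not-∧-true⁻ {false} {true} _ = refl , refl

⊔<⇒ˡ : ∀ {m n o} → m ⊔ n < o → m < o
⊔<⇒ˡ = m⊔n<o⇒m<o _ _

⊔<⇒ʳ : ∀ {m n o} → m ⊔ n < o → n < o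
⊔<⇒ʳ = m⊔n<o⇒n<o _ _

module _ {Θ : Signature} where

  maxVarT  : Term Θ → ℕ
  maxVarTs : ∀ {n} → Vec (Term Θ) n → ℕ
  maxVarT (var x)    = x
  maxVarT (app f ts) = maxVarTs ts
  maxVarTs []       = 0
  maxVarTs (t ∷ ts) = maxVarT t ⊔ maxVarTs ts

  maxVar : Fm Θ → ℕ
  maxVar (atom P ts) = maxVarTs ts
  maxVar ⊥'          = 0
  maxVar (α ∧' β)    = maxVar α ⊔ maxVar β
  maxVar (α ∨' β)    = maxVar α ⊔ maxVar β
  maxVar (α ⇒ β)     = maxVar α ⊔ maxVar β
  maxVar (¬' α)      = maxVar α
  maxVar (∀' y α)    = y ⊔ maxVar α
  maxVar (∃' y α)    = y ⊔ maxVar α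

  maxBoundVar : Fm Θ → ℕ
  maxBoundVar (atom P ts) = 0
  maxBoundVar ⊥'          = 0
  maxBoundVar (α ∧' β)    = maxBoundVar α ⊔ maxBoundVar β
  maxBoundVar (α ∨' β)    = maxBoundVar α ⊔ maxBoundVar β
  maxBoundVar (α ⇒ β)     = maxBoundVar α ⊔ maxBoundVar β
  maxBoundVar (¬' α)      = maxBoundVar α
  maxBoundVar (∀' y α)    = y ⊔ maxBoundVar α
  maxBoundVar (∃' y α)    = y ⊔ maxBoundVar α

  maxVarT<⇒notOcc  : ∀ u {z} → maxVarT u < z → occT z u ≡ false
  maxVarTs<⇒notOcc : ∀ {n} (us : Vec (Term Θ) n) {z} → maxVarTs us < z → occTs z us ≡ false
  maxVarT<⇒notOcc (var x)    h = ≢⇒==-false (>⇒≢ h)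
  maxVarT<⇒notOcc (app f ts) h = maxVarTs<⇒notOcc ts h
  maxVarTs<⇒notOcc []       h = refl
  maxVarTs<⇒notOcc (u ∷ us) h = ∨-false (maxVarT<⇒notOcc u (⊔<⇒ˡ h)) (maxVarTs<⇒notOcc us (⊔<⇒ʳ h))

  maxVar<⇒notFree : ∀ (α : Fm Θ) {z} → maxVar α < z → free z α ≡ false
  maxVar<⇒notFree (atom P ts) h = maxVarTs<⇒notOcc ts h
  maxVar<⇒notFree ⊥'          h = refl
  maxVar<⇒notFree (α ∧' β)    h = ∨-false (maxVar<⇒notFree α (⊔<⇒ˡ h)) (maxVar<⇒notFree β (⊔<⇒ʳ h))
  maxVar<⇒notFree (α ∨' β)    h = ∨-false (maxVar<⇒notFree α (⊔<⇒ˡ h)) (maxVar<⇒notFree β (⊔<⇒ʳ h))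
  maxVar<⇒notFree (α ⇒ β)     h = ∨-false (maxVar<⇒notFree α (⊔<⇒ˡ h)) (maxVar<⇒notFree β (⊔<⇒ʳ h))
  maxVar<⇒notFree (¬' α)      h = maxVar<⇒notFree α h
  maxVar<⇒notFree (∀' y α) {z} h =
    trans (not-false-∧ _ (≢⇒==-false (>⇒≢ (⊔<⇒ˡ h)))) (maxVar<⇒notFree α (⊔<⇒ʳ h))
  maxVar<⇒notFree (∃' y α) {z} h =
    trans (not-false-∧ _ (≢⇒==-false (>⇒≢ (⊔<⇒ˡ h)))) (maxVar<⇒notFree α (⊔<⇒ʳ h))

  substT-notOcc  : ∀ u {x} t → occT x u ≡ false → substT t x u ≡ u
  substTs-notOcc : ∀ {n} (us : Vec (Term Θ) n) {x} t → occTs x us ≡ false → substTs t x us ≡ us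
  substT-notOcc (var y)    t h rewrite h = refl
  substT-notOcc (app f ts) t h = cong (app f) (substTs-notOcc ts t h)
  substTs-notOcc []       t h = refl
  substTs-notOcc (u ∷ us) t h =
    cong₂ _∷_ (substT-notOcc u t (proj₁ (∨-false⁻ h))) (substTs-notOcc us t (proj₂ (∨-false⁻ h)))

  subst-notFree : ∀ (α : Fm Θ) {x} t → free x α ≡ false → α [ x / t ] ≡ α
  subst-notFree (atom P ts) t h = cong (atom P) (substTs-notOcc ts t h)
  subst-notFree ⊥'          t h = refl
  subst-notFree (α ∧' β)    t h =
    cong₂ _∧'_ (subst-notFree α t (proj₁ (∨-false⁻ h))) (subst-notFree β t (proj₂ (∨-false⁻ h)))
  subst-notFree (α ∨' β)    t h =
    cong₂ _∨'_ (subst-notFree α t (proj₁ (∨-false⁻ h))) (subst-notFree β t (proj₂ (∨-false⁻ h)))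
  subst-notFree (α ⇒ β)     t h =
    cong₂ _⇒_ (subst-notFree α t (proj₁ (∨-false⁻ h))) (subst-notFree β t (proj₂ (∨-false⁻ h)))
  subst-notFree (¬' α)      t h = cong ¬'_ (subst-notFree α t h)
  subst-notFree (∀' y α) {x} t h with x == y
  ... | true  = refl
  ... | false = cong (∀' y) (subst-notFree α t h)
  subst-notFree (∃' y α) {x} t h with x == y
  ... | true  = refl
  ... | false = cong (∃' y) (subst-notFree α t h)

  notFree⇒freeFor : ∀ (α : Fm Θ) {x} t → free x α ≡ false → FreeFor t x α
  notFree⇒freeFor (atom P ts) t h = tt
  notFree⇒freeFor ⊥'          t h = tt
  notFree⇒freeFor (α ∧' β)    t h =
    notFree⇒freeFor α t (proj₁ (∨-false⁻ h)) , notFree⇒freeFor β t (proj₂ (∨-false⁻ h))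
  notFree⇒freeFor (α ∨' β)    t h =
    notFree⇒freeFor α t (proj₁ (∨-false⁻ h)) , notFree⇒freeFor β t (proj₂ (∨-false⁻ h))
  notFree⇒freeFor (α ⇒ β)     t h =
    notFree⇒freeFor α t (proj₁ (∨-false⁻ h)) , notFree⇒freeFor β t (proj₂ (∨-false⁻ h))
  notFree⇒freeFor (¬' α)      t h = notFree⇒freeFor α t h
  notFree⇒freeFor (∀' y α)    t h = inj₁ h
  notFree⇒freeFor (∃' y α)    t h = inj₁ h

  closed⇒freeFor : ∀ (α : Fm Θ) t x → (∀ y → occT y t ≡ false) → FreeFor t x α
  closed⇒freeFor (atom P ts) t x h = tt
  closed⇒freeFor ⊥'          t x h = tt
  closed⇒freeFor (α ∧' β)    t x h = closed⇒freeFor α t x h , closed⇒freeFor β t x h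
  closed⇒freeFor (α ∨' β)    t x h = closed⇒freeFor α t x h , closed⇒freeFor β t x h
  closed⇒freeFor (α ⇒ β)     t x h = closed⇒freeFor α t x h , closed⇒freeFor β t x h
  closed⇒freeFor (¬' α)      t x h = closed⇒freeFor α t x h
  closed⇒freeFor (∀' y α)    t x h = inj₂ (h y , closed⇒freeFor α t x h)
  closed⇒freeFor (∃' y α)    t x h = inj₂ (h y , closed⇒freeFor α t x h)

  substT-self  : ∀ u x → substT (var x) x u ≡ u
  substTs-self : ∀ {n} (us : Vec (Term Θ) n) x → substTs (var x) x us ≡ us
  substT-self (var y) x with x == y in e
  ... | true  = cong var (==⇒≡ e)
  ... | false = refl
  substT-self (app f ts) x = cong (app f) (substTs-self ts x)
  substTs-self []       x = refl
  substTs-self (u ∷ us) x = cong₂ _∷_ (substT-self u x) (substTs-self us x)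

  subst-self : ∀ (α : Fm Θ) x → α [ x / var x ] ≡ α
  subst-self (atom P ts) x = cong (atom P) (substTs-self ts x)
  subst-self ⊥'          x = refl
  subst-self (α ∧' β)    x = cong₂ _∧'_ (subst-self α x) (subst-self β x)
  subst-self (α ∨' β)    x = cong₂ _∨'_ (subst-self α x) (subst-self β x)
  subst-self (α ⇒ β)     x = cong₂ _⇒_ (subst-self α x) (subst-self β x)
  subst-self (¬' α)      x = cong ¬'_ (subst-self α x)
  subst-self (∀' y α)    x with x == y
  ... | true  = refl
  ... | false = cong (∀' y) (subst-self α x)
  subst-self (∃' y α)    x with x == y
  ... | true  = refl
  ... | false = cong (∃' y) (subst-self α x)

  freeFor-self : ∀ (α : Fm Θ) x → FreeFor (var x) x α
  freeFor-self (atom P ts) x = tt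
  freeFor-self ⊥'          x = tt
  freeFor-self (α ∧' β)    x = freeFor-self α x , freeFor-self β x
  freeFor-self (α ∨' β)    x = freeFor-self α x , freeFor-self β x
  freeFor-self (α ⇒ β)     x = freeFor-self α x , freeFor-self β x
  freeFor-self (¬' α)      x = freeFor-self α x
  freeFor-self (∀' y α)    x with x == y in e
  ... | true  = inj₁ refl
  ... | false = inj₂ (trans (==-sym y x) e , freeFor-self α x)
  freeFor-self (∃' y α)    x with x == y in e
  ... | true  = inj₁ refl
  ... | false = inj₂ (trans (==-sym y x) e , freeFor-self α x)

  free⇒<suc-maxVar : ∀ (α : Fm Θ) w → free w α ≡ true → w < suc (maxVar α)
  free⇒<suc-maxVar α w fw with w ≤? maxVar α
  ... | yes w≤m = s≤s w≤m
  ... | no  w≰m = case trans (sym fw) (maxVar<⇒notFree α (≰⇒> w≰m)) of λ ()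

  ∀-closure : ℕ → Fm Θ → Fm Θ
  ∀-closure zero    φ = φ
  ∀-closure (suc n) φ = ∀' n (∀-closure n φ)

  free-∀-closure : ∀ n φ w → free w (∀-closure n φ) ≡ true → ¬ (w < n) × free w φ ≡ true
  free-∀-closure zero    φ w fw = (λ ()) , fw
  free-∀-closure (suc n) φ w fw with not-∧-true⁻ {w == n} fw
  ... | w≢n , fw′ with free-∀-closure n φ w fw′
  ...   | w≮n , fwφ = [ w≮n , ==-false⇒≢ w≢n ]′ ∘ m<1+n⇒m<n∨m≡n , fwφ

  substT-rename-inverse : ∀ (u : Term Θ) x z → occT z u ≡ false → substT (var x) z (substT (var z) x u) ≡ u
  substTs-rename-inverse : ∀ {n} (us : Vec (Term Θ) n) x z → occTs z us ≡ false →
                           substTs (var x) z (substTs (var z) x us) ≡ us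
  substT-rename-inverse (var y) x z h with x == y in e
  ... | true rewrite ==-refl z = cong var (==⇒≡ e)
  ... | false rewrite h = refl
  substT-rename-inverse (app f ts) x z h = cong (app f) (substTs-rename-inverse ts x z h)
  substTs-rename-inverse []       x z h = refl
  substTs-rename-inverse (u ∷ us) x z h =
    cong₂ _∷_ (substT-rename-inverse u x z (proj₁ (∨-false⁻ h)))
              (substTs-rename-inverse us x z (proj₂ (∨-false⁻ h)))

  subst-rename-inverse : ∀ (β : Fm Θ) x z → maxVar β < z → (β [ x / var z ]) [ z / var x ] ≡ β
  subst-rename-inverse (atom P ts) x z h = cong (atom P) (substTs-rename-inverse ts x z (maxVarTs<⇒notOcc ts h))
  subst-rename-inverse ⊥'          x z h = refl
  subst-rename-inverse (α ∧' β)    x z h =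
    cong₂ _∧'_ (subst-rename-inverse α x z (⊔<⇒ˡ h)) (subst-rename-inverse β x z (⊔<⇒ʳ h))
  subst-rename-inverse (α ∨' β)    x z h =
    cong₂ _∨'_ (subst-rename-inverse α x z (⊔<⇒ˡ h)) (subst-rename-inverse β x z (⊔<⇒ʳ h))
  subst-rename-inverse (α ⇒ β)     x z h =
    cong₂ _⇒_ (subst-rename-inverse α x z (⊔<⇒ˡ h)) (subst-rename-inverse β x z (⊔<⇒ʳ h))
  subst-rename-inverse (¬' α)      x z h = cong ¬'_ (subst-rename-inverse α x z h)
  subst-rename-inverse (∀' y β) x z h with x == y
  ... | true  rewrite ≢⇒==-false {z} {y} (>⇒≢ (⊔<⇒ˡ h)) =
    cong (∀' y) (subst-notFree β (var x) (maxVar<⇒notFree β (⊔<⇒ʳ h)))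
  ... | false rewrite ≢⇒==-false {z} {y} (>⇒≢ (⊔<⇒ˡ h)) = cong (∀' y) (subst-rename-inverse β x z (⊔<⇒ʳ h))
  subst-rename-inverse (∃' y β) x z h with x == y
  ... | true  rewrite ≢⇒==-false {z} {y} (>⇒≢ (⊔<⇒ˡ h)) =
    cong (∃' y) (subst-notFree β (var x) (maxVar<⇒notFree β (⊔<⇒ʳ h)))
  ... | false rewrite ≢⇒==-false {z} {y} (>⇒≢ (⊔<⇒ˡ h)) = cong (∃' y) (subst-rename-inverse β x z (⊔<⇒ʳ h))

  freeFor-rename-inverse : ∀ (β : Fm Θ) x z → maxVar β < z → FreeFor (var x) z (β [ x / var z ])
  freeFor-rename-inverse (atom P ts) x z h = tt
  freeFor-rename-inverse ⊥'          x z h = tt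
  freeFor-rename-inverse (α ∧' β)    x z h =
    freeFor-rename-inverse α x z (⊔<⇒ˡ h) , freeFor-rename-inverse β x z (⊔<⇒ʳ h)
  freeFor-rename-inverse (α ∨' β)    x z h =
    freeFor-rename-inverse α x z (⊔<⇒ˡ h) , freeFor-rename-inverse β x z (⊔<⇒ʳ h)
  freeFor-rename-inverse (α ⇒ β)     x z h =
    freeFor-rename-inverse α x z (⊔<⇒ˡ h) , freeFor-rename-inverse β x z (⊔<⇒ʳ h)
  freeFor-rename-inverse (¬' α)      x z h = freeFor-rename-inverse α x z h
  freeFor-rename-inverse (∀' y β) x z h with x == y in e
  ... | true  = inj₁ (maxVar<⇒notFree (∀' y β) h)
  ... | false = inj₂ (trans (==-sym y x) e , freeFor-rename-inverse β x z (⊔<⇒ʳ h))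
  freeFor-rename-inverse (∃' y β) x z h with x == y in e
  ... | true  = inj₁ (maxVar<⇒notFree (∃' y β) h)
  ... | false = inj₂ (trans (==-sym y x) e , freeFor-rename-inverse β x z (⊔<⇒ʳ h))

  substT-renamed-notOcc : ∀ (u : Term Θ) x z → (x == z) ≡ false → occT x (substT (var z) x u) ≡ false
  substTs-renamed-notOcc : ∀ {n} (us : Vec (Term Θ) n) x z → (x == z) ≡ false →
                           occTs x (substTs (var z) x us) ≡ false
  substT-renamed-notOcc (var y) x z h with x == y in e
  ... | true  = h
  ... | false = e
  substT-renamed-notOcc (app f ts) x z h = substTs-renamed-notOcc ts x z h
  substTs-renamed-notOcc []       x z h = refl
  substTs-renamed-notOcc (u ∷ us) x z h = ∨-false (substT-renamed-notOcc u x z h) (substTs-renamed-notOcc us x z h)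

  renamed-notFree : ∀ (β : Fm Θ) x z → (x == z) ≡ false → free x (β [ x / var z ]) ≡ false
  renamed-notFree (atom P ts) x z h = substTs-renamed-notOcc ts x z h
  renamed-notFree ⊥'          x z h = refl
  renamed-notFree (α ∧' β)    x z h = ∨-false (renamed-notFree α x z h) (renamed-notFree β x z h)
  renamed-notFree (α ∨' β)    x z h = ∨-false (renamed-notFree α x z h) (renamed-notFree β x z h)
  renamed-notFree (α ⇒ β)     x z h = ∨-false (renamed-notFree α x z h) (renamed-notFree β x z h)
  renamed-notFree (¬' α)      x z h = renamed-notFree α x z h
  renamed-notFree (∀' y β) x z h with x == y in e
  ... | true  = not-true-∧ _ e
  ... | false = trans (not-false-∧ _ e) (renamed-notFree β x z h)
  renamed-notFree (∃' y β) x z h with x == y in e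
  ... | true  = not-true-∧ _ e
  ... | false = trans (not-false-∧ _ e) (renamed-notFree β x z h)

-- Derived rules of QN4

module _ {Θ : Signature} {Γ : Fm Θ → Set} where

  ⇒-refl : ∀ α → Γ ⊢ α ⇒ α
  ⇒-refl α = MP (N1 α α) (MP (N1 α (α ⇒ α)) (N2 α (α ⇒ α) α))

  ⇒-const : ∀ {β} α → Γ ⊢ β → Γ ⊢ α ⇒ β
  ⇒-const {β} α b = MP b (N1 β α)

  ⇒-app : ∀ {a b c} → Γ ⊢ a ⇒ (b ⇒ c) → Γ ⊢ a ⇒ b → Γ ⊢ a ⇒ c
  ⇒-app {a} {b} {c} f g = MP g (MP f (N2 a b c))

  ⇒-trans : ∀ {a b c} → Γ ⊢ a ⇒ b → Γ ⊢ b ⇒ c → Γ ⊢ a ⇒ c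
  ⇒-trans {a} f g = ⇒-app (⇒-const a g) f

  ⇒-pair : ∀ {a b c} → Γ ⊢ c ⇒ a → Γ ⊢ c ⇒ b → Γ ⊢ c ⇒ (a ∧' b)
  ⇒-pair {a} {b} f g = ⇒-app (⇒-trans f (N5 a b)) g

  ⇒-case : ∀ {a b c} → Γ ⊢ a ⇒ c → Γ ⊢ b ⇒ c → Γ ⊢ (a ∨' b) ⇒ c
  ⇒-case {a} {b} {c} f g = MP g (MP f (N8 a b c))

  ⇒-post : ∀ {a b} c → Γ ⊢ a ⇒ b → Γ ⊢ (c ⇒ a) ⇒ (c ⇒ b)
  ⇒-post {a} {b} c f = MP (⇒-const c f) (N2 c a b)

  ⇒-curry : ∀ {a b c} → Γ ⊢ (a ∧' b) ⇒ c → Γ ⊢ a ⇒ (b ⇒ c)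
  ⇒-curry {a} {b} f = ⇒-trans (N5 a b) (⇒-post b f)

  ⇒-uncurry : ∀ {a b c} → Γ ⊢ a ⇒ (b ⇒ c) → Γ ⊢ (a ∧' b) ⇒ c
  ⇒-uncurry {a} {b} f = ⇒-app (⇒-trans (N4 a b) f) (N3 a b)

  ⇔'-to : ∀ {a b} → Γ ⊢ a ⇔' b → Γ ⊢ a ⇒ b
  ⇔'-to {a} {b} h = MP h (N4 (a ⇒ b) (b ⇒ a))

  ⇔'-from : ∀ {a b} → Γ ⊢ a ⇔' b → Γ ⊢ b ⇒ a
  ⇔'-from {a} {b} h = MP h (N3 (a ⇒ b) (b ⇒ a))

  gen : ∀ {ψ} x → Γ ⊢ ψ → Γ ⊢ ∀' x ψ
  gen x h = MP (⇒-refl ⊥') (R∀ x refl (⇒-const (⊥' ⇒ ⊥') h))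

  inst : ∀ {ψ} x → Γ ⊢ ∀' x ψ → Γ ⊢ ψ
  inst {ψ} x h = subst (Γ ⊢_) (subst-self ψ x) (MP h (A2 ψ x (var x) (freeFor-self ψ x)))

  ∀-rename : ∀ β x z → maxVar β < z → (x == z) ≡ false → Γ ⊢ ∀' z (β [ x / var z ]) ⇒ ∀' x β
  ∀-rename β x z β<z x≢z =
    R∀ x (trans (not-false-∧ _ x≢z) (renamed-notFree β x z x≢z))
      (subst (λ χ → Γ ⊢ ∀' z (β [ x / var z ]) ⇒ χ) (subst-rename-inverse β x z β<z)
        (A2 (β [ x / var z ]) z (var x) (freeFor-rename-inverse β x z β<z)))

  ∃-rename : ∀ β x z → maxVar β < z → (x == z) ≡ false → Γ ⊢ ∃' x β ⇒ ∃' z (β [ x / var z ])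
  ∃-rename β x z β<z x≢z =
    R∃ x (trans (not-false-∧ _ x≢z) (renamed-notFree β x z x≢z))
      (subst (λ χ → Γ ⊢ χ ⇒ ∃' z (β [ x / var z ])) (subst-rename-inverse β x z β<z)
        (A1 (β [ x / var z ]) z (var x) (freeFor-rename-inverse β x z β<z)))

  instantiate : ∀ {ψ} x t → (∀ y → occT y t ≡ false) → Γ ⊢ ψ → Γ ⊢ ψ [ x / t ]
  instantiate {ψ} x t closed d = MP (gen x d) (A2 ψ x t (closed⇒freeFor ψ t x closed))

  inst-∀-closure : ∀ n φ → Γ ⊢ ∀-closure n φ → Γ ⊢ φ
  inst-∀-closure zero    φ d = d
  inst-∀-closure (suc n) φ d = inst-∀-closure n φ (inst n d)

-- Soundness

module Soundness {c ℓ s} {Θ : Signature} (𝔄 : ThetaStructure {Θ} c ℓ s) where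
  open ThetaStructure 𝔄
  open IsDistributiveLattice isDistributiveLattice
    using (antisym; reflexive; ∧-greatest; ∨-least; x∧y≤x; x∧y≤y; x≤x∨y; y≤x∨y; ∧-distribˡ-∨; module Eq)
    renaming (refl to ≤-refl; trans to ≤-trans)

  _[_↦_] : (Var → S) → Var → S → Var → S
  _[_↦_] = update {Θ}

  ≈⇒≤ : ∀ {x y} → x ≈ y → x ≤ y
  ≈⇒≤ = reflexive

  ≈⇒≥ : ∀ {x y} → x ≈ y → y ≤ x
  ≈⇒≥ e = reflexive (Eq.sym e)

  π₁ : ∀ {x y} → (x ⊓ y) ≤ x
  π₁ = x∧y≤x _ _

  π₂ : ∀ {x y} → (x ⊓ y) ≤ y
  π₂ = x∧y≤y _ _

  ⇨-elim : ∀ {z a b} → z ≤ (a ⇨ b) → z ≤ a → z ≤ b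
  ⇨-elim {z} {a} {b} f x = ≤-trans (∧-greatest ≤-refl x) (proj₂ (exponential z a b) f)

  ⇨-intro : ∀ {z a b} → (z ⊓ a) ≤ b → z ≤ (a ⇨ b)
  ⇨-intro {z} {a} {b} = proj₁ (exponential z a b)

  ‖⇒‖-elim : ∀ {z α β v} → z ≤ ‖ α ⇒ β ‖ v → z ≤ ‖ α ‖ v → z ≤ ‖ β ‖ v
  ‖⇒‖-elim {α = α} {β} {v} f = ⇨-elim (≤-trans f (≈⇒≤ (‖⇒‖ α β v)))

  ‖⇒‖-intro : ∀ {z α β v} → (z ⊓ ‖ α ‖ v) ≤ ‖ β ‖ v → z ≤ ‖ α ⇒ β ‖ v
  ‖⇒‖-intro {α = α} {β} {v} f = ≤-trans (⇨-intro f) (≈⇒≥ (‖⇒‖ α β v))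

  Valid : Fm Θ → (Var → S) → Set ℓ
  Valid φ v = 𝟏 ≤ ‖ φ ‖ v

  ≤⇒valid-⇒ : ∀ {α β v} → ‖ α ‖ v ≤ ‖ β ‖ v → Valid (α ⇒ β) v
  ≤⇒valid-⇒ f = ‖⇒‖-intro (≤-trans π₂ f)

  valid-⇒⇒≤ : ∀ {α β v} → Valid (α ⇒ β) v → ‖ α ‖ v ≤ ‖ β ‖ v
  valid-⇒⇒≤ f = ‖⇒‖-elim (≤-trans (maximum _) f) ≤-refl

  ≈⇒valid-⇔' : ∀ {α β v} → ‖ α ‖ v ≈ ‖ β ‖ v → Valid (α ⇔' β) v
  ≈⇒valid-⇔' {α} {β} {v} e =
    ≤-trans (∧-greatest (≤⇒valid-⇒ (≈⇒≤ e)) (≤⇒valid-⇒ (≈⇒≥ e)))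
            (≈⇒≥ (‖∧‖ (α ⇒ β) (β ⇒ α) v))

  -- The coincidence lemma is not among the clauses of ‖_‖; it follows from
  -- ‖subst‖ for the renaming of x into suc x, which leaves α unchanged.
  ‖‖-update-notFree : ∀ α x → free x α ≡ false → ∀ v a → ‖ α ‖ v ≈ ‖ α ‖ (v [ x ↦ a ])
  ‖‖-update-notFree α x nf v a =
    Eq.trans (renaming-invisible v) (Eq.trans (‖‖-ext α _ _ agree) (Eq.sym (renaming-invisible w)))
    where
    y = suc x
    w = v [ x ↦ a ]
    renaming-invisible : ∀ u → ‖ α ‖ u ≈ ‖ α ‖ (u [ x ↦ u y ])
    renaming-invisible u =
      subst (λ φ → ‖ φ ‖ u ≈ ‖ α ‖ (u [ x ↦ u y ])) (subst-notFree α (var y) nf)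
            (‖subst‖ α x (var y) u (notFree⇒freeFor α (var y) nf))
    agree : ∀ z → (v [ x ↦ v y ]) z ≡ (w [ x ↦ w y ]) z
    agree z with z == x
    ... | true rewrite ≢⇒==-false {y} {x} (λ ()) = refl
    ... | false = refl

  sound : ∀ {Γ φ} → Γ ⊢ φ → (∀ γ → Γ γ → 𝔄 ⊨ₛ γ) → ∀ v → Valid φ v
  sound (hyp {φ} g) H v = ≈⇒≥ (H φ g v)
  sound (N1 α β)    H v = ≤⇒valid-⇒ (‖⇒‖-intro π₁)
  sound (N2 α β γ)  H v = ≤⇒valid-⇒ (‖⇒‖-intro (‖⇒‖-intro
    (‖⇒‖-elim (‖⇒‖-elim (≤-trans π₁ π₁) π₂) (‖⇒‖-elim (≤-trans π₁ π₂) π₂))))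
  sound (N3 α β)    H v = ≤⇒valid-⇒ (≤-trans (≈⇒≤ (‖∧‖ α β v)) π₂)
  sound (N4 α β)    H v = ≤⇒valid-⇒ (≤-trans (≈⇒≤ (‖∧‖ α β v)) π₁)
  sound (N5 α β)    H v = ≤⇒valid-⇒ (‖⇒‖-intro (≈⇒≥ (‖∧‖ α β v)))
  sound (N6 α β)    H v = ≤⇒valid-⇒ (≤-trans (x≤x∨y _ _) (≈⇒≥ (‖∨‖ α β v)))
  sound (N7 α β)    H v = ≤⇒valid-⇒ (≤-trans (y≤x∨y _ _) (≈⇒≥ (‖∨‖ α β v)))
  sound (N8 α β γ)  H v = ≤⇒valid-⇒ (‖⇒‖-intro (‖⇒‖-intro by-cases))
    where
    W = ‖ α ⇒ γ ‖ v ⊓ ‖ β ⇒ γ ‖ v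
    by-cases : (W ⊓ ‖ α ∨' β ‖ v) ≤ ‖ γ ‖ v
    by-cases = ≤-trans (∧-greatest π₁ (≤-trans π₂ (≈⇒≤ (‖∨‖ α β v))))
                 (≤-trans (≈⇒≤ (∧-distribˡ-∨ W (‖ α ‖ v) (‖ β ‖ v)))
                   (∨-least (‖⇒‖-elim (≤-trans π₁ π₁) π₂) (‖⇒‖-elim (≤-trans π₁ π₂) π₂)))
  sound (N9 α β)    H v = ≈⇒valid-⇔' (Eq.trans (‖¬⇒‖ α β v) (Eq.sym (‖∧‖ α (¬' β) v)))
  sound (N10 α β)   H v = ≈⇒valid-⇔' (Eq.trans (‖¬∧‖ α β v) (Eq.sym (‖∨‖ (¬' α) (¬' β) v)))
  sound (N11 α β)   H v = ≈⇒valid-⇔' (Eq.trans (‖¬∨‖ α β v) (Eq.sym (‖∧‖ (¬' α) (¬' β) v)))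
  sound (N12 α)     H v = ≈⇒valid-⇔' (‖¬¬‖ α v)
  sound (A1 φ x t ff) H v = ≤⇒valid-⇒
    (≤-trans (≈⇒≤ (‖subst‖ φ x t v ff)) (≤-trans (⋁-upper _ (evalT v t)) (≈⇒≥ (‖∃‖ x φ v))))
  sound (A2 φ x t ff) H v = ≤⇒valid-⇒
    (≤-trans (≈⇒≤ (‖∀‖ x φ v)) (≤-trans (⋀-lower _ (evalT v t)) (≈⇒≥ (‖subst‖ φ x t v ff))))
  sound (MP d e) H v = ‖⇒‖-elim (sound e H v) (sound d H v)
  sound (R∃ {α} {β} x nf d) H v = ≤⇒valid-⇒ (≤-trans (≈⇒≤ (‖∃‖ x α v))
    (⋁-least _ _ (λ a → ≤-trans (valid-⇒⇒≤ (sound d H (v [ x ↦ a ])))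
                                 (≈⇒≥ (‖‖-update-notFree β x nf v a)))))
  sound (R∀ {α} {β} x nf d) H v = ≤⇒valid-⇒ (≤-trans
    (⋀-greatest _ _ (λ a → ≤-trans (≈⇒≤ (‖‖-update-notFree α x nf v a))
                                    (valid-⇒⇒≤ (sound d H (v [ x ↦ a ])))))
    (≈⇒≥ (‖∀‖ x β v)))

  valid⇒⊨ₛ : ∀ {φ} → (∀ v → Valid φ v) → 𝔄 ⊨ₛ φ
  valid⇒⊨ₛ h v = antisym (maximum _) (h v)

  ⊨ₛ-∀ : ∀ φ x → 𝔄 ⊨ₛ φ → 𝔄 ⊨ₛ ∀' x φ
  ⊨ₛ-∀ φ x h = valid⇒⊨ₛ λ v →
    ≤-trans (⋀-greatest _ _ (λ a → ≈⇒≥ (h (v [ x ↦ a ])))) (≈⇒≥ (‖∀‖ x φ v))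

  ⊨ₛ-∀-closure : ∀ n φ → 𝔄 ⊨ₛ φ → 𝔄 ⊨ₛ ∀-closure n φ
  ⊨ₛ-∀-closure zero    φ h = h
  ⊨ₛ-∀-closure (suc n) φ h = ⊨ₛ-∀ (∀-closure n φ) n (⊨ₛ-∀-closure n φ h)

soundness : ∀ {Θ} {Γ : Fm Θ → Set} {φ} → Γ ⊢ φ → Γ ⊨ φ
soundness d 𝔄 H = valid⇒⊨ₛ (sound d H)
  where open Soundness 𝔄

-- Renaming function symbols

withFunSyms : (Θ : Signature) (F : Set) → (F → ℕ) → Signature
withFunSyms Θ F a = record
  { PredSym = PredSym Θ ; predArity = predArity Θ ; FunSym = F ; funArity = a ; somePred = somePred Θ }

maxBinder : ∀ {Θ} {Γ : Fm Θ → Set} {ψ} → Γ ⊢ ψ → ℕ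
maxBinder (A1 φ x t _) = x ⊔ maxBoundVar φ
maxBinder (A2 φ x t _) = x ⊔ maxBoundVar φ
maxBinder (MP d e)     = maxBinder d ⊔ maxBinder e
maxBinder (R∃ x _ d)   = x ⊔ maxBinder d
maxBinder (R∀ x _ d)   = x ⊔ maxBinder d
maxBinder _            = 0

-- Each function symbol f is replaced by a term former h f which may
-- introduce the variable z but otherwise behaves like an application.
-- Derivations in which z is never bound translate to derivations.
module SymbolTranslation
  {Θ : Signature} (F : Set) (a : F → ℕ)
  (h : (f : FunSym Θ) → Vec (Term (withFunSyms Θ F a)) (funArity Θ f) → Term (withFunSyms Θ F a))
  (z : Var)
  (h-occ : ∀ f us x → (x == z) ≡ false → occT x (h f us) ≡ occTs x us)
  (h-subst : ∀ f us s x → (x == z) ≡ false → h f (substTs s x us) ≡ substT s x (h f us))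
  where

  Θ₂ : Signature
  Θ₂ = withFunSyms Θ F a

  trT  : Term Θ → Term Θ₂
  trTs : ∀ {n} → Vec (Term Θ) n → Vec (Term Θ₂) n
  trT (var x)    = var x
  trT (app f ts) = h f (trTs ts)
  trTs []       = []
  trTs (t ∷ ts) = trT t ∷ trTs ts

  tr : Fm Θ → Fm Θ₂
  tr (atom P ts) = atom P (trTs ts)
  tr ⊥'          = ⊥'
  tr (α ∧' β)    = tr α ∧' tr β
  tr (α ∨' β)    = tr α ∨' tr β
  tr (α ⇒ β)     = tr α ⇒ tr β
  tr (¬' α)      = ¬' tr α
  tr (∀' x α)    = ∀' x (tr α)
  tr (∃' x α)    = ∃' x (tr α)

  occT-trT  : ∀ u x → (x == z) ≡ false → occT x (trT u) ≡ occT x u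
  occTs-trTs : ∀ {n} (us : Vec (Term Θ) n) x → (x == z) ≡ false → occTs x (trTs us) ≡ occTs x us
  occT-trT (var y)    x e = refl
  occT-trT (app f ts) x e = trans (h-occ f (trTs ts) x e) (occTs-trTs ts x e)
  occTs-trTs []       x e = refl
  occTs-trTs (u ∷ us) x e = cong₂ _∨_ (occT-trT u x e) (occTs-trTs us x e)

  free-tr : ∀ α x → (x == z) ≡ false → free x (tr α) ≡ free x α
  free-tr (atom P ts) x e = occTs-trTs ts x e
  free-tr ⊥'          x e = refl
  free-tr (α ∧' β)    x e = cong₂ _∨_ (free-tr α x e) (free-tr β x e)
  free-tr (α ∨' β)    x e = cong₂ _∨_ (free-tr α x e) (free-tr β x e)
  free-tr (α ⇒ β)     x e = cong₂ _∨_ (free-tr α x e) (free-tr β x e)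
  free-tr (¬' α)      x e = free-tr α x e
  free-tr (∀' y α)    x e = cong (not (x == y) ∧_) (free-tr α x e)
  free-tr (∃' y α)    x e = cong (not (x == y) ∧_) (free-tr α x e)

  trT-substT   : ∀ u t x → (x == z) ≡ false → trT (substT t x u) ≡ substT (trT t) x (trT u)
  trTs-substTs : ∀ {n} (us : Vec (Term Θ) n) t x → (x == z) ≡ false →
                 trTs (substTs t x us) ≡ substTs (trT t) x (trTs us)
  trT-substT (var y) t x e with x == y
  ... | true  = refl
  ... | false = refl
  trT-substT (app f ts) t x e = trans (cong (h f) (trTs-substTs ts t x e)) (h-subst f (trTs ts) (trT t) x e)
  trTs-substTs []       t x e = refl
  trTs-substTs (u ∷ us) t x e = cong₂ _∷_ (trT-substT u t x e) (trTs-substTs us t x e)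

  tr-subst : ∀ α t x → (x == z) ≡ false → tr (α [ x / t ]) ≡ (tr α) [ x / trT t ]
  tr-subst (atom P ts) t x e = cong (atom P) (trTs-substTs ts t x e)
  tr-subst ⊥'          t x e = refl
  tr-subst (α ∧' β)    t x e = cong₂ _∧'_ (tr-subst α t x e) (tr-subst β t x e)
  tr-subst (α ∨' β)    t x e = cong₂ _∨'_ (tr-subst α t x e) (tr-subst β t x e)
  tr-subst (α ⇒ β)     t x e = cong₂ _⇒_ (tr-subst α t x e) (tr-subst β t x e)
  tr-subst (¬' α)      t x e = cong ¬'_ (tr-subst α t x e)
  tr-subst (∀' y α)    t x e with x == y
  ... | true  = refl
  ... | false = cong (∀' y) (tr-subst α t x e)
  tr-subst (∃' y α)    t x e with x == y
  ... | true  = refl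
  ... | false = cong (∃' y) (tr-subst α t x e)

  <z⇒≢z : ∀ {x} → x < z → (x == z) ≡ false
  <z⇒≢z x<z = ≢⇒==-false (<⇒≢ x<z)

  freeFor-tr : ∀ α t x → (x == z) ≡ false → maxBoundVar α < z → FreeFor t x α → FreeFor (trT t) x (tr α)
  freeFor-tr (atom P ts) t x e b ff = tt
  freeFor-tr ⊥'          t x e b ff = tt
  freeFor-tr (α ∧' β)    t x e b ff = freeFor-tr α t x e (⊔<⇒ˡ b) (proj₁ ff) , freeFor-tr β t x e (⊔<⇒ʳ b) (proj₂ ff)
  freeFor-tr (α ∨' β)    t x e b ff = freeFor-tr α t x e (⊔<⇒ˡ b) (proj₁ ff) , freeFor-tr β t x e (⊔<⇒ʳ b) (proj₂ ff)
  freeFor-tr (α ⇒ β)     t x e b ff = freeFor-tr α t x e (⊔<⇒ˡ b) (proj₁ ff) , freeFor-tr β t x e (⊔<⇒ʳ b) (proj₂ ff)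
  freeFor-tr (¬' α)      t x e b ff = freeFor-tr α t x e b ff
  freeFor-tr (∀' y α)    t x e b (inj₁ nf) = inj₁ (trans (free-tr (∀' y α) x e) nf)
  freeFor-tr (∀' y α)    t x e b (inj₂ (ny , ff)) =
    inj₂ (trans (occT-trT t y (<z⇒≢z (⊔<⇒ˡ b))) ny , freeFor-tr α t x e (⊔<⇒ʳ b) ff)
  freeFor-tr (∃' y α)    t x e b (inj₁ nf) = inj₁ (trans (free-tr (∃' y α) x e) nf)
  freeFor-tr (∃' y α)    t x e b (inj₂ (ny , ff)) =
    inj₂ (trans (occT-trT t y (<z⇒≢z (⊔<⇒ˡ b))) ny , freeFor-tr α t x e (⊔<⇒ʳ b) ff)

  tr-⊢ : ∀ {Γ₁ : Fm Θ → Set} {Γ₂ : Fm Θ₂ → Set} → (∀ ψ → Γ₁ ψ → Γ₂ (tr ψ)) →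
         ∀ {ψ} (d : Γ₁ ⊢ ψ) → maxBinder d < z → Γ₂ ⊢ tr ψ
  tr-⊢ H (hyp {ψ} g) b = hyp (H ψ g)
  tr-⊢ H (N1 α β)    b = N1 _ _
  tr-⊢ H (N2 α β γ)  b = N2 _ _ _
  tr-⊢ H (N3 α β)    b = N3 _ _
  tr-⊢ H (N4 α β)    b = N4 _ _
  tr-⊢ H (N5 α β)    b = N5 _ _
  tr-⊢ H (N6 α β)    b = N6 _ _
  tr-⊢ H (N7 α β)    b = N7 _ _
  tr-⊢ H (N8 α β γ)  b = N8 _ _ _
  tr-⊢ H (N9 α β)    b = N9 _ _
  tr-⊢ H (N10 α β)   b = N10 _ _
  tr-⊢ H (N11 α β)   b = N11 _ _
  tr-⊢ H (N12 α)     b = N12 _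
  tr-⊢ {Γ₂ = Γ₂} H (A1 φ x t ff) b =
    subst (λ χ → Γ₂ ⊢ χ ⇒ ∃' x (tr φ)) (sym (tr-subst φ t x x≢z))
      (A1 (tr φ) x (trT t) (freeFor-tr φ t x x≢z (⊔<⇒ʳ b) ff))
    where x≢z = <z⇒≢z (⊔<⇒ˡ b)
  tr-⊢ {Γ₂ = Γ₂} H (A2 φ x t ff) b =
    subst (λ χ → Γ₂ ⊢ ∀' x (tr φ) ⇒ χ) (sym (tr-subst φ t x x≢z))
      (A2 (tr φ) x (trT t) (freeFor-tr φ t x x≢z (⊔<⇒ʳ b) ff))
    where x≢z = <z⇒≢z (⊔<⇒ˡ b)
  tr-⊢ H (MP d e) b = MP (tr-⊢ H d (⊔<⇒ˡ b)) (tr-⊢ H e (⊔<⇒ʳ b))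
  tr-⊢ H (R∃ {α} {β} x nf d) b = R∃ x (trans (free-tr β x (<z⇒≢z (⊔<⇒ˡ b))) nf) (tr-⊢ H d (⊔<⇒ʳ b))
  tr-⊢ H (R∀ {α} {β} x nf d) b = R∀ x (trans (free-tr α x (<z⇒≢z (⊔<⇒ˡ b))) nf) (tr-⊢ H d (⊔<⇒ʳ b))

-- Parameters

module Parameters (Θ : Signature) where

  ParamSym : Set
  ParamSym = FunSym Θ ⊎ ℕ

  paramArity : ParamSym → ℕ
  paramArity (inj₁ f) = funArity Θ f
  paramArity (inj₂ _) = 0

  Θ⁺ : Signature
  Θ⁺ = withFunSyms Θ ParamSym paramArity

  data ClosedTerm : Set where
    capp : (f : ParamSym) → Vec ClosedTerm (paramArity f) → ClosedTerm

  param : ℕ → ClosedTerm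
  param p = capp (inj₂ p) []

  ⌜_⌝  : ClosedTerm → Term Θ⁺
  ⌜_⌝s : ∀ {n} → Vec ClosedTerm n → Vec (Term Θ⁺) n
  ⌜ capp f cs ⌝ = app f ⌜ cs ⌝s
  ⌜ [] ⌝s       = []
  ⌜ c ∷ cs ⌝s   = ⌜ c ⌝ ∷ ⌜ cs ⌝s

  ⌜⌝-closed  : ∀ c y → occT y ⌜ c ⌝ ≡ false
  ⌜⌝s-closed : ∀ {n} (cs : Vec ClosedTerm n) y → occTs y ⌜ cs ⌝s ≡ false
  ⌜⌝-closed (capp f cs) y = ⌜⌝s-closed cs y
  ⌜⌝s-closed []       y = refl
  ⌜⌝s-closed (c ∷ cs) y = ∨-false (⌜⌝-closed c y) (⌜⌝s-closed cs y)

  Subst : Set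
  Subst = Var → Term Θ⁺

  _[_↦_] : Subst → Var → Term Θ⁺ → Subst
  _[_↦_] = update {Θ⁺}

  embedT  : Subst → Term Θ → Term Θ⁺
  embedTs : ∀ {n} → Subst → Vec (Term Θ) n → Vec (Term Θ⁺) n
  embedT ρ (var x)    = ρ x
  embedT ρ (app f ts) = app (inj₁ f) (embedTs ρ ts)
  embedTs ρ []       = []
  embedTs ρ (t ∷ ts) = embedT ρ t ∷ embedTs ρ ts

  -- Bound variables are not renamed, so ρ must be capture-free; it is only
  -- ever instantiated with variables and closed terms.
  embed : Subst → Fm Θ → Fm Θ⁺
  embed ρ (atom P ts) = atom P (embedTs ρ ts)
  embed ρ ⊥'          = ⊥'
  embed ρ (α ∧' β)    = embed ρ α ∧' embed ρ β
  embed ρ (α ∨' β)    = embed ρ α ∨' embed ρ β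
  embed ρ (α ⇒ β)     = embed ρ α ⇒ embed ρ β
  embed ρ (¬' α)      = ¬' embed ρ α
  embed ρ (∀' x α)    = ∀' x (embed (ρ [ x ↦ var x ]) α)
  embed ρ (∃' x α)    = ∃' x (embed (ρ [ x ↦ var x ]) α)

  embedT-congOcc  : ∀ (t : Term Θ) ρ σ → (∀ z → occT z t ≡ true → ρ z ≡ σ z) → embedT ρ t ≡ embedT σ t
  embedTs-congOcc : ∀ {n} (ts : Vec (Term Θ) n) ρ σ → (∀ z → occTs z ts ≡ true → ρ z ≡ σ z) →
                    embedTs ρ ts ≡ embedTs σ ts
  embedT-congOcc (var x)    ρ σ h = h x (==-refl x)
  embedT-congOcc (app f ts) ρ σ h = cong (app (inj₁ f)) (embedTs-congOcc ts ρ σ h)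
  embedTs-congOcc []       ρ σ h = refl
  embedTs-congOcc (t ∷ ts) ρ σ h =
    cong₂ _∷_ (embedT-congOcc t ρ σ (λ z e → h z (∨-trueˡ _ e)))
              (embedTs-congOcc ts ρ σ (λ z e → h z (∨-trueʳ _ e)))

  under-binder : ∀ x (α : Fm Θ) ρ σ → (∀ z → not (z == x) ∧ free z α ≡ true → ρ z ≡ σ z) →
                 ∀ z → free z α ≡ true → (ρ [ x ↦ var x ]) z ≡ (σ [ x ↦ var x ]) z
  under-binder x α ρ σ h z fz with z == x in e
  ... | true  = refl
  ... | false = h z (trans (not-false-∧ _ e) fz)

  embed-congFree : ∀ (α : Fm Θ) ρ σ → (∀ z → free z α ≡ true → ρ z ≡ σ z) → embed ρ α ≡ embed σ α
  embed-congFree (atom P ts) ρ σ h = cong (atom P) (embedTs-congOcc ts ρ σ h)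
  embed-congFree ⊥'          ρ σ h = refl
  embed-congFree (α ∧' β)    ρ σ h =
    cong₂ _∧'_ (embed-congFree α ρ σ (λ z e → h z (∨-trueˡ _ e))) (embed-congFree β ρ σ (λ z e → h z (∨-trueʳ _ e)))
  embed-congFree (α ∨' β)    ρ σ h =
    cong₂ _∨'_ (embed-congFree α ρ σ (λ z e → h z (∨-trueˡ _ e))) (embed-congFree β ρ σ (λ z e → h z (∨-trueʳ _ e)))
  embed-congFree (α ⇒ β)     ρ σ h =
    cong₂ _⇒_ (embed-congFree α ρ σ (λ z e → h z (∨-trueˡ _ e))) (embed-congFree β ρ σ (λ z e → h z (∨-trueʳ _ e)))
  embed-congFree (¬' α)      ρ σ h = cong ¬'_ (embed-congFree α ρ σ h)
  embed-congFree (∀' x α)    ρ σ h = cong (∀' x) (embed-congFree α _ _ (under-binder x α ρ σ h))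
  embed-congFree (∃' x α)    ρ σ h = cong (∃' x) (embed-congFree α _ _ (under-binder x α ρ σ h))

  embed-cong : ∀ (α : Fm Θ) ρ σ → (∀ z → ρ z ≡ σ z) → embed ρ α ≡ embed σ α
  embed-cong α ρ σ h = embed-congFree α ρ σ (λ z _ → h z)

  substT-embedT   : ∀ (u : Term Θ) ρ x t → substT t x (embedT ρ u) ≡ embedT (substT t x ∘ ρ) u
  substTs-embedTs : ∀ {n} (us : Vec (Term Θ) n) ρ x t → substTs t x (embedTs ρ us) ≡ embedTs (substT t x ∘ ρ) us
  substT-embedT (var w)    ρ x t = refl
  substT-embedT (app f ts) ρ x t = cong (app (inj₁ f)) (substTs-embedTs ts ρ x t)
  substTs-embedTs []       ρ x t = refl
  substTs-embedTs (u ∷ us) ρ x t = cong₂ _∷_ (substT-embedT u ρ x t) (substTs-embedTs us ρ x t)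

  VarOnlyAt : Var → Subst → Set
  VarOnlyAt x ρ = ∀ w → (w == x) ≡ false → occT x (ρ w) ≡ false

  varOnlyAt-under-binder : ∀ ρ x y → (x == y) ≡ false → VarOnlyAt x ρ → VarOnlyAt x (ρ [ y ↦ var y ])
  varOnlyAt-under-binder ρ x y e h w ew with w == y
  ... | true  = e
  ... | false = h w ew

  substT-under-binder : ∀ ρ x y t → (x == y) ≡ false →
                        ∀ w → substT t x ((ρ [ y ↦ var y ]) w) ≡ ((substT t x ∘ ρ) [ y ↦ var y ]) w
  substT-under-binder ρ x y t e w with w == y
  ... | true rewrite e = refl
  ... | false = refl

  substT-at-binder : ∀ ρ x y t → x ≡ y → VarOnlyAt x ρ →
                     ∀ w → (ρ [ y ↦ var y ]) w ≡ ((substT t x ∘ ρ) [ y ↦ var y ]) w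
  substT-at-binder ρ x y t refl h w with w == x in e
  ... | true  = refl
  ... | false = sym (substT-notOcc (ρ w) t (h w e))

  subst-embed : ∀ (α : Fm Θ) ρ x t → VarOnlyAt x ρ → (∀ y → occT y t ≡ false) →
                (embed ρ α) [ x / t ] ≡ embed (substT t x ∘ ρ) α
  subst-embed (atom P ts) ρ x t h c = cong (atom P) (substTs-embedTs ts ρ x t)
  subst-embed ⊥'          ρ x t h c = refl
  subst-embed (α ∧' β)    ρ x t h c = cong₂ _∧'_ (subst-embed α ρ x t h c) (subst-embed β ρ x t h c)
  subst-embed (α ∨' β)    ρ x t h c = cong₂ _∨'_ (subst-embed α ρ x t h c) (subst-embed β ρ x t h c)
  subst-embed (α ⇒ β)     ρ x t h c = cong₂ _⇒_ (subst-embed α ρ x t h c) (subst-embed β ρ x t h c)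
  subst-embed (¬' α)      ρ x t h c = cong ¬'_ (subst-embed α ρ x t h c)
  subst-embed (∀' y α)    ρ x t h c with x == y in e
  ... | true  = cong (∀' y) (embed-cong α _ _ (substT-at-binder ρ x y t (==⇒≡ e) h))
  ... | false = cong (∀' y) (trans (subst-embed α _ x t (varOnlyAt-under-binder ρ x y e h) c)
                                   (embed-cong α _ _ (substT-under-binder ρ x y t e)))
  subst-embed (∃' y α)    ρ x t h c with x == y in e
  ... | true  = cong (∃' y) (embed-cong α _ _ (substT-at-binder ρ x y t (==⇒≡ e) h))
  ... | false = cong (∃' y) (trans (subst-embed α _ x t (varOnlyAt-under-binder ρ x y e h) c)
                                   (embed-cong α _ _ (substT-under-binder ρ x y t e)))

  embedT-substT   : ∀ (u : Term Θ) ρ x t → embedT ρ (substT t x u) ≡ embedT (ρ [ x ↦ embedT ρ t ]) u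
  embedTs-substTs : ∀ {n} (us : Vec (Term Θ) n) ρ x t →
                    embedTs ρ (substTs t x us) ≡ embedTs (ρ [ x ↦ embedT ρ t ]) us
  embedT-substT (var y) ρ x t rewrite ==-sym y x with x == y
  ... | true  = refl
  ... | false = refl
  embedT-substT (app f ts) ρ x t = cong (app (inj₁ f)) (embedTs-substTs ts ρ x t)
  embedTs-substTs []       ρ x t = refl
  embedTs-substTs (u ∷ us) ρ x t = cong₂ _∷_ (embedT-substT u ρ x t) (embedTs-substTs us ρ x t)

  update-shadowed : ∀ ρ x y s → x ≡ y → ∀ w → (ρ [ y ↦ var y ]) w ≡ ((ρ [ x ↦ s ]) [ y ↦ var y ]) w
  update-shadowed ρ x y s refl w with w == x
  ... | true  = refl
  ... | false = refl

  update-notFree : ∀ (α : Fm Θ) ρ x y s → free x α ≡ false →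
                   ∀ w → free w α ≡ true → (ρ [ y ↦ var y ]) w ≡ ((ρ [ x ↦ s ]) [ y ↦ var y ]) w
  update-notFree α ρ x y s nf w fw with w == y
  ... | true = refl
  ... | false with w == x in e
  ...   | true rewrite ==⇒≡ e = case trans (sym fw) nf of λ ()
  ...   | false = refl

  embedT-update-notOcc : ∀ ρ y s (t : Term Θ) → occT y t ≡ false → embedT (ρ [ y ↦ s ]) t ≡ embedT ρ t
  embedT-update-notOcc ρ y s t ny = embedT-congOcc t _ _ agree
    where
    agree : ∀ z → occT z t ≡ true → (ρ [ y ↦ s ]) z ≡ ρ z
    agree z oz with z == y in ez
    ... | true rewrite ==⇒≡ ez = case trans (sym oz) ny of λ ()
    ... | false = refl

  update-commute : ∀ ρ x y (t : Term Θ) → (x == y) ≡ false → occT y t ≡ false →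
                   ∀ w → ((ρ [ y ↦ var y ]) [ x ↦ embedT (ρ [ y ↦ var y ]) t ]) w ≡
                         ((ρ [ x ↦ embedT ρ t ]) [ y ↦ var y ]) w
  update-commute ρ x y t e ny w rewrite embedT-update-notOcc ρ y (var y) t ny
    with w == x in e₁ | w == y in e₂
  ... | true  | true  = case trans (sym (trans (cong (_== y) (sym (==⇒≡ e₁))) e₂)) e of λ ()
  ... | true  | false = refl
  ... | false | true  = refl
  ... | false | false = refl

  embed-subst : ∀ (α : Fm Θ) ρ x t → FreeFor t x α → embed ρ (α [ x / t ]) ≡ embed (ρ [ x ↦ embedT ρ t ]) α
  embed-subst (atom P ts) ρ x t ff = cong (atom P) (embedTs-substTs ts ρ x t)
  embed-subst ⊥'          ρ x t ff = refl
  embed-subst (α ∧' β)    ρ x t ff = cong₂ _∧'_ (embed-subst α ρ x t (proj₁ ff)) (embed-subst β ρ x t (proj₂ ff))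
  embed-subst (α ∨' β)    ρ x t ff = cong₂ _∨'_ (embed-subst α ρ x t (proj₁ ff)) (embed-subst β ρ x t (proj₂ ff))
  embed-subst (α ⇒ β)     ρ x t ff = cong₂ _⇒_ (embed-subst α ρ x t (proj₁ ff)) (embed-subst β ρ x t (proj₂ ff))
  embed-subst (¬' α)      ρ x t ff = cong ¬'_ (embed-subst α ρ x t ff)
  embed-subst (∀' y α) ρ x t ff with x == y in e
  ... | true = cong (∀' y) (embed-cong α _ _ (update-shadowed ρ x y _ (==⇒≡ e)))
  embed-subst (∀' y α) ρ x t (inj₁ nf) | false rewrite subst-notFree α t nf =
    cong (∀' y) (embed-congFree α _ _ (update-notFree α ρ x y _ nf))
  embed-subst (∀' y α) ρ x t (inj₂ (ny , ff)) | false =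
    cong (∀' y) (trans (embed-subst α _ x t ff) (embed-cong α _ _ (update-commute ρ x y t e ny)))
  embed-subst (∃' y α) ρ x t ff with x == y in e
  ... | true = cong (∃' y) (embed-cong α _ _ (update-shadowed ρ x y _ (==⇒≡ e)))
  embed-subst (∃' y α) ρ x t (inj₁ nf) | false rewrite subst-notFree α t nf =
    cong (∃' y) (embed-congFree α _ _ (update-notFree α ρ x y _ nf))
  embed-subst (∃' y α) ρ x t (inj₂ (ny , ff)) | false =
    cong (∃' y) (trans (embed-subst α _ x t ff) (embed-cong α _ _ (update-commute ρ x y t e ny)))

  maxParamT  : Term Θ⁺ → ℕ
  maxParamTs : ∀ {n} → Vec (Term Θ⁺) n → ℕ
  maxParamT (var x)             = 0
  maxParamT (app (inj₁ f) ts)   = maxParamTs ts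
  maxParamT (app (inj₂ q) ts)   = q ⊔ maxParamTs ts
  maxParamTs []       = 0
  maxParamTs (t ∷ ts) = maxParamT t ⊔ maxParamTs ts

  maxParam : Fm Θ⁺ → ℕ
  maxParam (atom P ts) = maxParamTs ts
  maxParam ⊥'          = 0
  maxParam (α ∧' β)    = maxParam α ⊔ maxParam β
  maxParam (α ∨' β)    = maxParam α ⊔ maxParam β
  maxParam (α ⇒ β)     = maxParam α ⊔ maxParam β
  maxParam (¬' α)      = maxParam α
  maxParam (∀' y α)    = maxParam α
  maxParam (∃' y α)    = maxParam α

  paramToVar : ℕ → Var → (f : ParamSym) → Vec (Term Θ⁺) (paramArity f) → Term Θ⁺
  paramToVar p z (inj₁ f) ts = app (inj₁ f) ts
  paramToVar p z (inj₂ q) [] = if q == p then var z else app (inj₂ q) []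

  occT-paramToVar : ∀ p z f us x → (x == z) ≡ false → occT x (paramToVar p z f us) ≡ occTs x us
  occT-paramToVar p z (inj₁ f) us x e = refl
  occT-paramToVar p z (inj₂ q) [] x e with q == p
  ... | true  = e
  ... | false = refl

  paramToVar-substT : ∀ p z f us s x → (x == z) ≡ false →
                      paramToVar p z f (substTs s x us) ≡ substT s x (paramToVar p z f us)
  paramToVar-substT p z (inj₁ f) us s x e = refl
  paramToVar-substT p z (inj₂ q) [] s x e with q == p
  ... | true rewrite e = refl
  ... | false = refl

  module ParamToVar (p : ℕ) (z : Var) =
    SymbolTranslation {Θ⁺} ParamSym paramArity (paramToVar p z) z (occT-paramToVar p z) (paramToVar-substT p z)

  module _ (p : ℕ) (z : Var) where
    open ParamToVar p z

    trT-param : trT ⌜ param p ⌝ ≡ var z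
    trT-param rewrite ==-refl p = refl

    trT-fresh  : ∀ u → maxParamT u < p → trT u ≡ u
    trTs-fresh : ∀ {n} (us : Vec (Term Θ⁺) n) → maxParamTs us < p → trTs us ≡ us
    trT-fresh (var x) h = refl
    trT-fresh (app (inj₁ f) ts) h = cong (app (inj₁ f)) (trTs-fresh ts h)
    trT-fresh (app (inj₂ q) []) h with q == p in e
    ... | true  = ⊥-elim (<⇒≢ (⊔<⇒ˡ h) (==⇒≡ e))
    ... | false = refl
    trTs-fresh []       h = refl
    trTs-fresh (u ∷ us) h = cong₂ _∷_ (trT-fresh u (⊔<⇒ˡ h)) (trTs-fresh us (⊔<⇒ʳ h))

    tr-fresh : ∀ ψ → maxParam ψ < p → tr ψ ≡ ψ
    tr-fresh (atom P ts) h = cong (atom P) (trTs-fresh ts h)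
    tr-fresh ⊥'          h = refl
    tr-fresh (α ∧' β)    h = cong₂ _∧'_ (tr-fresh α (⊔<⇒ˡ h)) (tr-fresh β (⊔<⇒ʳ h))
    tr-fresh (α ∨' β)    h = cong₂ _∨'_ (tr-fresh α (⊔<⇒ˡ h)) (tr-fresh β (⊔<⇒ʳ h))
    tr-fresh (α ⇒ β)     h = cong₂ _⇒_ (tr-fresh α (⊔<⇒ˡ h)) (tr-fresh β (⊔<⇒ʳ h))
    tr-fresh (¬' α)      h = cong ¬'_ (tr-fresh α h)
    tr-fresh (∀' y α)    h = cong (∀' y) (tr-fresh α h)
    tr-fresh (∃' y α)    h = cong (∃' y) (tr-fresh α h)

    Fixed : Subst → Set
    Fixed ρ = ∀ w → trT (ρ w) ≡ ρ w

    fixed-under-binder : ∀ ρ x → Fixed ρ → Fixed (ρ [ x ↦ var x ])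
    fixed-under-binder ρ x h w with w == x
    ... | true  = refl
    ... | false = h w

    trT-embedT  : ∀ ρ (t : Term Θ) → Fixed ρ → trT (embedT ρ t) ≡ embedT ρ t
    trTs-embedTs : ∀ ρ {n} (ts : Vec (Term Θ) n) → Fixed ρ → trTs (embedTs ρ ts) ≡ embedTs ρ ts
    trT-embedT ρ (var x)    h = h x
    trT-embedT ρ (app f ts) h = cong (app (inj₁ f)) (trTs-embedTs ρ ts h)
    trTs-embedTs ρ []       h = refl
    trTs-embedTs ρ (t ∷ ts) h = cong₂ _∷_ (trT-embedT ρ t h) (trTs-embedTs ρ ts h)

    tr-embed : ∀ ρ (γ : Fm Θ) → Fixed ρ → tr (embed ρ γ) ≡ embed ρ γ
    tr-embed ρ (atom P ts) h = cong (atom P) (trTs-embedTs ρ ts h)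
    tr-embed ρ ⊥'          h = refl
    tr-embed ρ (α ∧' β)    h = cong₂ _∧'_ (tr-embed ρ α h) (tr-embed ρ β h)
    tr-embed ρ (α ∨' β)    h = cong₂ _∨'_ (tr-embed ρ α h) (tr-embed ρ β h)
    tr-embed ρ (α ⇒ β)     h = cong₂ _⇒_ (tr-embed ρ α h) (tr-embed ρ β h)
    tr-embed ρ (¬' α)      h = cong ¬'_ (tr-embed ρ α h)
    tr-embed ρ (∀' x α)    h = cong (∀' x) (tr-embed _ α (fixed-under-binder ρ x h))
    tr-embed ρ (∃' x α)    h = cong (∃' x) (tr-embed _ α (fixed-under-binder ρ x h))

  paramsToVar : Var → (f : ParamSym) → Vec (Term Θ) (paramArity f) → Term Θ
  paramsToVar z (inj₁ f) ts = app f ts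
  paramsToVar z (inj₂ q) [] = var z

  occT-paramsToVar : ∀ z f us x → (x == z) ≡ false → occT x (paramsToVar z f us) ≡ occTs x us
  occT-paramsToVar z (inj₁ f) us x e = refl
  occT-paramsToVar z (inj₂ q) [] x e = e

  paramsToVar-substT : ∀ z f us s x → (x == z) ≡ false →
                       paramsToVar z f (substTs s x us) ≡ substT s x (paramsToVar z f us)
  paramsToVar-substT z (inj₁ f) us s x e = refl
  paramsToVar-substT z (inj₂ q) [] s x e rewrite e = refl

  module ParamsToVar (z : Var) =
    SymbolTranslation {Θ⁺} (FunSym Θ) (funArity Θ) (paramsToVar z) z (occT-paramsToVar z) (paramsToVar-substT z)

  module _ (z : Var) where
    open ParamsToVar z

    Inverts : Subst → Set
    Inverts ρ = ∀ w → trT (ρ w) ≡ var w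

    inverts-under-binder : ∀ ρ x → Inverts ρ → Inverts (ρ [ x ↦ var x ])
    inverts-under-binder ρ x h w with w == x in e
    ... | true  = cong var (sym (==⇒≡ e))
    ... | false = h w

    trT-embedT-inverse  : ∀ ρ (t : Term Θ) → Inverts ρ → trT (embedT ρ t) ≡ t
    trTs-embedTs-inverse : ∀ ρ {n} (ts : Vec (Term Θ) n) → Inverts ρ → trTs (embedTs ρ ts) ≡ ts
    trT-embedT-inverse ρ (var x)    h = h x
    trT-embedT-inverse ρ (app f ts) h = cong (app f) (trTs-embedTs-inverse ρ ts h)
    trTs-embedTs-inverse ρ []       h = refl
    trTs-embedTs-inverse ρ (t ∷ ts) h = cong₂ _∷_ (trT-embedT-inverse ρ t h) (trTs-embedTs-inverse ρ ts h)

    tr-embed-inverse : ∀ ρ (γ : Fm Θ) → Inverts ρ → tr (embed ρ γ) ≡ γ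
    tr-embed-inverse ρ (atom P ts) h = cong (atom P) (trTs-embedTs-inverse ρ ts h)
    tr-embed-inverse ρ ⊥'          h = refl
    tr-embed-inverse ρ (α ∧' β)    h = cong₂ _∧'_ (tr-embed-inverse ρ α h) (tr-embed-inverse ρ β h)
    tr-embed-inverse ρ (α ∨' β)    h = cong₂ _∨'_ (tr-embed-inverse ρ α h) (tr-embed-inverse ρ β h)
    tr-embed-inverse ρ (α ⇒ β)     h = cong₂ _⇒_ (tr-embed-inverse ρ α h) (tr-embed-inverse ρ β h)
    tr-embed-inverse ρ (¬' α)      h = cong ¬'_ (tr-embed-inverse ρ α h)
    tr-embed-inverse ρ (∀' x α)    h = cong (∀' x) (tr-embed-inverse _ α (inverts-under-binder ρ x h))
    tr-embed-inverse ρ (∃' x α)    h = cong (∃' x) (tr-embed-inverse _ α (inverts-under-binder ρ x h))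

-- The canonical model

module CanonicalModel {Θ : Signature} (Γ : Fm Θ → Set) where
  open Parameters Θ

  Γ⁺ : Fm Θ⁺ → Set
  Γ⁺ ψ = Σ (Fm Θ) (λ γ → Γ γ × embed var γ ≡ ψ)

  hyp-paramToVar : ∀ p z ψ → Γ⁺ ψ → Γ⁺ (ParamToVar.tr p z ψ)
  hyp-paramToVar p z ψ (γ , g , refl) = γ , g , sym (tr-embed p z var γ (λ w → refl))

  freshParam : Fm Θ⁺ → Fm Θ⁺ → ℕ
  freshParam a b = suc (maxParam a ⊔ maxParam b)

  -- A derivation about a fresh parameter becomes one about a fresh variable
  -- z, which can then be generalised by R∀ / R∃.
  module FreshParamToVar (d₀ β : Fm Θ⁺) (x : Var) {ψ} (D : Γ⁺ ⊢ ψ) where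
    p : ℕ
    p = freshParam d₀ β

    z : Var
    z = suc (maxBinder D ⊔ maxVar (d₀ ⇒ ∀' x β))

    open ParamToVar p z using (tr; tr-subst; tr-⊢) public

    d₀<z : maxVar d₀ < z
    d₀<z = ⊔<⇒ˡ (s≤s (m≤n⊔m (maxBinder D) _))

    x≢z : (x == z) ≡ false
    x≢z = ≢⇒==-false (<⇒≢ (⊔<⇒ˡ (⊔<⇒ʳ {maxVar d₀} (s≤s (m≤n⊔m (maxBinder D) _)))))

    β<z : maxVar β < z
    β<z = ⊔<⇒ʳ {x} (⊔<⇒ʳ {maxVar d₀} (s≤s (m≤n⊔m (maxBinder D) _)))

    tr-d₀ : tr d₀ ≡ d₀
    tr-d₀ = tr-fresh p z d₀ (s≤s (m≤m⊔n _ _))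

    tr-instance : tr (β [ x / ⌜ param p ⌝ ]) ≡ β [ x / var z ]
    tr-instance = trans (tr-subst β ⌜ param p ⌝ x x≢z)
                        (cong₂ (λ α t → α [ x / t ]) (tr-fresh p z β (s≤s (m≤n⊔m _ _))) (trT-param p z))

    tr-D : Γ⁺ ⊢ tr ψ
    tr-D = tr-⊢ (hyp-paramToVar p z) D (s≤s (m≤m⊔n _ _))

  ⇒-∀-param : ∀ d₀ x β → (∀ c → Γ⁺ ⊢ d₀ ⇒ β [ x / ⌜ c ⌝ ]) → Γ⁺ ⊢ d₀ ⇒ ∀' x β
  ⇒-∀-param d₀ x β H = ⇒-trans (R∀ z (maxVar<⇒notFree d₀ d₀<z) D′) (∀-rename β x z β<z x≢z)
    where
    open FreshParamToVar d₀ β x (H (param (freshParam d₀ β)))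
    D′ : Γ⁺ ⊢ d₀ ⇒ β [ x / var z ]
    D′ = subst (Γ⁺ ⊢_) (cong₂ _⇒_ tr-d₀ tr-instance) tr-D

  ∃-⇒-param : ∀ d₀ x β → (∀ c → Γ⁺ ⊢ β [ x / ⌜ c ⌝ ] ⇒ d₀) → Γ⁺ ⊢ ∃' x β ⇒ d₀
  ∃-⇒-param d₀ x β H = ⇒-trans (∃-rename β x z β<z x≢z) (R∃ z (maxVar<⇒notFree d₀ d₀<z) D′)
    where
    open FreshParamToVar d₀ β x (H (param (freshParam d₀ β)))
    D′ : Γ⁺ ⊢ β [ x / var z ] ⇒ d₀
    D′ = subst (Γ⁺ ⊢_) (cong₂ _⇒_ tr-instance tr-d₀) tr-D

  _≼_ : Fm Θ⁺ → Fm Θ⁺ → Set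
  a ≼ b = Γ⁺ ⊢ a ⇒ b

  UpperBound : (Fm Θ⁺ → Set) → Fm Θ⁺ → Set
  UpperBound U d = ∀ a → U a → a ≼ d

  -- The Dedekind–MacNeille completion of the Lindenbaum algebra of Γ⁺:
  -- a set of formulas is an element iff it contains every lower bound of
  -- its upper bounds.
  record NormalIdeal : Set₁ where
    field
      mem    : Fm Θ⁺ → Set
      closed : ∀ c → (∀ d → UpperBound mem d → c ≼ d) → mem c
  open NormalIdeal public

  infix 4 _⊑_ _≋_
  record _⊑_ (X Y : NormalIdeal) : Set₁ where
    constructor mk⊑
    field within : ∀ c → mem X c → mem Y c
  open _⊑_

  _≋_ : NormalIdeal → NormalIdeal → Set₁
  X ≋ Y = (X ⊑ Y) × (Y ⊑ X)

  ⊑-refl : ∀ {X} → X ⊑ X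
  ⊑-refl = mk⊑ (λ c m → m)

  ⊑-trans : ∀ {X Y Z} → X ⊑ Y → Y ⊑ Z → X ⊑ Z
  ⊑-trans p q = mk⊑ (λ c m → within q c (within p c m))

  ≋-trans : ∀ {X Y Z} → X ≋ Y → Y ≋ Z → X ≋ Z
  ≋-trans (p , q) (r , s) = ⊑-trans p r , ⊑-trans s q

  down-closed : ∀ X {c c′} → mem X c → c′ ≼ c → mem X c′
  down-closed X {c} {c′} m le = closed X c′ (λ d ub → ⇒-trans le (ub c m))

  closure : (Fm Θ⁺ → Set) → NormalIdeal
  closure U = record { mem = λ c → ∀ d → UpperBound U d → c ≼ d
                     ; closed = λ c h d ub → h d (λ a m → m d ub) }

  closure-least : ∀ {U} Z → (∀ a → U a → mem Z a) → closure U ⊑ Z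
  closure-least Z h = mk⊑ (λ c m → closed Z c (λ d ub → m d (λ a u → ub a (h a u))))

  closure-upper : ∀ {U} a → U a → mem (closure U) a
  closure-upper a u d ub = ub a u

  ↓ : Fm Θ⁺ → NormalIdeal
  ↓ a = record { mem = _≼ a ; closed = λ c h → h a (λ a′ m → m) }

  infixr 6 _⊓_
  infixr 5 _⊔'_
  infixr 4 _⇨_

  _⊓_ : NormalIdeal → NormalIdeal → NormalIdeal
  X ⊓ Y = record { mem = λ c → mem X c × mem Y c
                 ; closed = λ c h → closed X c (λ d ub → h d (λ a m → ub a (proj₁ m)))
                                  , closed Y c (λ d ub → h d (λ a m → ub a (proj₂ m))) }

  ⋀ : {J : Set} → (J → NormalIdeal) → NormalIdeal
  ⋀ f = record { mem = λ c → ∀ i → mem (f i) c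
               ; closed = λ c h i → closed (f i) c (λ d ub → h d (λ a m → ub a (m i))) }

  _⊔'_ : NormalIdeal → NormalIdeal → NormalIdeal
  X ⊔' Y = closure (λ a → mem X a ⊎ mem Y a)

  ⋁ : {J : Set} → (J → NormalIdeal) → NormalIdeal
  ⋁ {J} f = closure (λ a → Σ J (λ i → mem (f i) a))

  _⇨_ : NormalIdeal → NormalIdeal → NormalIdeal
  X ⇨ Y = record
    { mem = λ c → ∀ a → mem X a → mem Y (c ∧' a)
    ; closed = λ c h a ma → closed Y (c ∧' a) (λ d ub →
        ⇒-uncurry (h (a ⇒ d) (λ e me → ⇒-curry (ub (e ∧' a) (me a ma))))) }

  𝟏 : NormalIdeal
  𝟏 = record { mem = λ _ → ⊤ ; closed = λ _ _ → tt }

  ∧-comm-≼ : ∀ a b → (a ∧' b) ≼ (b ∧' a)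
  ∧-comm-≼ a b = ⇒-pair (N3 a b) (N4 a b)

  contract : ∀ {c d} → c ≼ (c ⇒ d) → c ≼ d
  contract {c} h = ⇒-app h (⇒-refl c)

  ⊓-distribˡ-⊔' : ∀ X Y Z → (X ⊓ (Y ⊔' Z)) ≋ ((X ⊓ Y) ⊔' (X ⊓ Z))
  ⊓-distribˡ-⊔' X Y Z = mk⊑ distribute , closure-least (X ⊓ (Y ⊔' Z)) collect
    where
    distribute : ∀ c → mem (X ⊓ (Y ⊔' Z)) c → mem ((X ⊓ Y) ⊔' (X ⊓ Z)) c
    distribute c (mx , my) d ub = contract (my (c ⇒ d) ub′)
      where
      ub′ : UpperBound (λ a → mem Y a ⊎ mem Z a) (c ⇒ d)
      ub′ a (inj₁ m) = ⇒-curry (⇒-trans (∧-comm-≼ a c)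
        (ub (c ∧' a) (inj₁ (down-closed X mx (N4 c a) , down-closed Y m (N3 c a)))))
      ub′ a (inj₂ m) = ⇒-curry (⇒-trans (∧-comm-≼ a c)
        (ub (c ∧' a) (inj₂ (down-closed X mx (N4 c a) , down-closed Z m (N3 c a)))))
    collect : ∀ a → mem (X ⊓ Y) a ⊎ mem (X ⊓ Z) a → mem (X ⊓ (Y ⊔' Z)) a
    collect a (inj₁ (mx , my)) = mx , closure-upper a (inj₁ my)
    collect a (inj₂ (mx , mz)) = mx , closure-upper a (inj₂ mz)

  isDistributiveLattice : IsDistributiveLattice _≋_ _⊑_ _⊔'_ _⊓_
  isDistributiveLattice = record
    { isLattice = record
      { isPartialOrder = record
        { isPreorder = record
          { isEquivalence = record
            { refl = ⊑-refl , ⊑-refl ; sym = λ (p , q) → q , p ; trans = ≋-trans }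
          ; reflexive = proj₁
          ; trans = ⊑-trans }
        ; antisym = _,_ }
      ; supremum = λ X Y → mk⊑ (λ c m → closure-upper c (inj₁ m))
                         , mk⊑ (λ c m → closure-upper c (inj₂ m))
                         , λ Z p q → closure-least Z (λ { a (inj₁ m) → within p a m ; a (inj₂ m) → within q a m })
      ; infimum = λ X Y → mk⊑ (λ c m → proj₁ m) , mk⊑ (λ c m → proj₂ m)
                        , λ Z p q → mk⊑ (λ c m → within p c m , within q c m) }
    ; ∧-distribˡ-∨ = ⊓-distribˡ-⊔' }

  completion : CompleteGHA (lsuc lzero) (lsuc lzero) lzero
  completion = record
    { Carrier = NormalIdeal
    ; _≈_ = _≋_
    ; _≤_ = _⊑_
    ; _⊔'_ = _⊔'_
    ; _⊓_ = _⊓_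
    ; _⇨_ = _⇨_
    ; 𝟏 = 𝟏
    ; isDistributiveLattice = isDistributiveLattice
    ; maximum = λ X → mk⊑ (λ c m → tt)
    ; exponential = λ W X Y →
        (λ p → mk⊑ (λ c mw a mx → within p (c ∧' a) (down-closed W mw (N4 c a) , down-closed X mx (N3 c a))))
      , (λ p → mk⊑ (λ c m → down-closed Y (within p c (proj₁ m) c (proj₂ m)) (⇒-pair (⇒-refl c) (⇒-refl c))))
    ; ⋀ = ⋀
    ; ⋁ = ⋁
    ; ⋀-lower = λ f i → mk⊑ (λ c m → m i)
    ; ⋀-greatest = λ f Z h → mk⊑ (λ c m i → within (h i) c m)
    ; ⋁-upper = λ f i → mk⊑ (λ c m → closure-upper c (i , m))
    ; ⋁-least = λ f Z h → closure-least Z (λ a (i , m) → within (h i) a m)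
    }

  -- Strong negation is interpreted freely: ¬' α is just another formula of
  -- the Lindenbaum algebra, so the relations N_x can be taken to be total.
  completionN4 : CompleteN4Structure (lsuc lzero) (lsuc lzero) lzero
  completionN4 = record
    { A = completion
    ; N = λ _ _ → Lift (lsuc lzero) ⊤
    ; N-resp = λ _ _ _ → lift tt
    ; N-nonempty = λ x → x , lift tt
    ; N-∧ = λ _ _ → lift tt
    ; N-∨ = λ _ _ → lift tt
    ; N-inv = λ _ → lift tt
    ; N-⇨ = λ _ → lift tt
    }

  ↓-≋ : ∀ {a b} → a ≼ b → b ≼ a → ↓ a ≋ ↓ b
  ↓-≋ p q = mk⊑ (λ c m → ⇒-trans m p) , mk⊑ (λ c m → ⇒-trans m q)

  ↓-⇔' : ∀ {a b} → Γ⁺ ⊢ a ⇔' b → ↓ a ≋ ↓ b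
  ↓-⇔' h = ↓-≋ (⇔'-to h) (⇔'-from h)

  ↓-cong : ∀ {a b} → a ≡ b → ↓ a ≋ ↓ b
  ↓-cong refl = ⊑-refl , ⊑-refl

  ↓-∧ : ∀ a b → ↓ (a ∧' b) ≋ (↓ a ⊓ ↓ b)
  ↓-∧ a b = mk⊑ (λ c m → ⇒-trans m (N4 a b) , ⇒-trans m (N3 a b))
          , mk⊑ (λ c m → ⇒-pair (proj₁ m) (proj₂ m))

  ↓-∨ : ∀ a b → ↓ (a ∨' b) ≋ (↓ a ⊔' ↓ b)
  ↓-∨ a b = mk⊑ (λ c m d ub → ⇒-trans m (⇒-case (ub a (inj₁ (⇒-refl a))) (ub b (inj₂ (⇒-refl b)))))
          , closure-least (↓ (a ∨' b)) λ { c (inj₁ m) → ⇒-trans m (N6 a b)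
                                          ; c (inj₂ m) → ⇒-trans m (N7 a b) }

  ↓-⇒ : ∀ a b → ↓ (a ⇒ b) ≋ (↓ a ⇨ ↓ b)
  ↓-⇒ a b = mk⊑ (λ c m a′ m′ → ⇒-uncurry (⇒-trans m (antecedent-weaken m′)))
          , mk⊑ (λ c m → ⇒-curry (m a (⇒-refl a)))
    where
    antecedent-weaken : ∀ {a′} → a′ ≼ a → (a ⇒ b) ≼ (a′ ⇒ b)
    antecedent-weaken {a′} h = ⇒-curry (⇒-app (N4 (a ⇒ b) a′) (⇒-trans (N3 (a ⇒ b) a′) h))

  ↓-glb : ∀ {J : Set} t (b : J → Fm Θ⁺) → (∀ i → t ≼ b i) → (∀ c → (∀ i → c ≼ b i) → c ≼ t) →
          ↓ t ≋ ⋀ (λ i → ↓ (b i))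
  ↓-glb t b lower greatest = mk⊑ (λ c m i → ⇒-trans m (lower i)) , mk⊑ greatest

  ↓-lub : ∀ {J : Set} t (b : J → Fm Θ⁺) → (∀ i → b i ≼ t) → (∀ d → (∀ i → b i ≼ d) → t ≼ d) →
          ↓ t ≋ ⋁ (λ i → ↓ (b i))
  ↓-lub t b upper least = mk⊑ (λ c m d ub → ⇒-trans m (least d (λ i → ub (b i) (i , ⇒-refl (b i)))))
                        , closure-least (↓ t) (λ a (i , m) → ⇒-trans m (upper i))

  ↓≋𝟏⇒⊢ : ∀ a → ↓ a ≋ 𝟏 → Γ⁺ ⊢ a
  ↓≋𝟏⇒⊢ a (_ , q) = MP (⇒-refl ⊥') (within q (⊥' ⇒ ⊥') tt)

  Valuation : Set
  Valuation = Var → ClosedTerm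

  _[_≔_] : Valuation → Var → ClosedTerm → Valuation
  _[_≔_] = update {Θ}

  asSubst : Valuation → Subst
  asSubst v w = ⌜ v w ⌝

  open TermEval {Θ} ClosedTerm (λ f → capp (inj₁ f))

  ⌜evalT⌝  : ∀ v (t : Term Θ) → ⌜ evalT v t ⌝ ≡ embedT (asSubst v) t
  ⌜evalTs⌝ : ∀ v {n} (ts : Vec (Term Θ) n) → ⌜ evalTs v ts ⌝s ≡ embedTs (asSubst v) ts
  ⌜evalT⌝ v (var x)    = refl
  ⌜evalT⌝ v (app f ts) = cong (app (inj₁ f)) (⌜evalTs⌝ v ts)
  ⌜evalTs⌝ v []       = refl
  ⌜evalTs⌝ v (t ∷ ts) = cong₂ _∷_ (⌜evalT⌝ v t) (⌜evalTs⌝ v ts)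

  value : Fm Θ → Valuation → NormalIdeal
  value α v = ↓ (embed (asSubst v) α)

  instance-embed : ∀ v x (α : Fm Θ) c →
                   (embed (asSubst v [ x ↦ var x ]) α) [ x / ⌜ c ⌝ ] ≡ embed (asSubst (v [ x ≔ c ])) α
  instance-embed v x α c = trans (subst-embed α _ x ⌜ c ⌝ only-at (λ y → ⌜⌝-closed c y)) (embed-cong α _ _ agree)
    where
    only-at : VarOnlyAt x (asSubst v [ x ↦ var x ])
    only-at w e rewrite e = ⌜⌝-closed (v w) x
    agree : ∀ w → substT ⌜ c ⌝ x ((asSubst v [ x ↦ var x ]) w) ≡ asSubst (v [ x ≔ c ]) w
    agree w with w == x
    ... | true rewrite ==-refl x = refl
    ... | false = substT-notOcc ⌜ v w ⌝ ⌜ c ⌝ (⌜⌝-closed (v w) x)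

  instance-⊢ : ∀ v x (α : Fm Θ) c → Γ⁺ ⊢ embed (asSubst v) (∀' x α) ⇒ embed (asSubst (v [ x ≔ c ])) α
  instance-⊢ v x α c = subst (λ χ → Γ⁺ ⊢ _ ⇒ χ) (instance-embed v x α c)
                         (A2 body x ⌜ c ⌝ (closed⇒freeFor body ⌜ c ⌝ x (λ y → ⌜⌝-closed c y)))
    where body = embed (asSubst v [ x ↦ var x ]) α

  witness-⊢ : ∀ v x (α : Fm Θ) c → Γ⁺ ⊢ embed (asSubst (v [ x ≔ c ])) α ⇒ embed (asSubst v) (∃' x α)
  witness-⊢ v x α c = subst (λ χ → Γ⁺ ⊢ χ ⇒ _) (instance-embed v x α c)
                        (A1 body x ⌜ c ⌝ (closed⇒freeFor body ⌜ c ⌝ x (λ y → ⌜⌝-closed c y)))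
    where body = embed (asSubst v [ x ↦ var x ]) α

  value-∀ : ∀ x α v → value (∀' x α) v ≋ ⋀ (λ c → value α (v [ x ≔ c ]))
  value-∀ x α v = ↓-glb _ _ (instance-⊢ v x α)
    (λ d h → ⇒-∀-param d x _ (λ c → subst (λ χ → Γ⁺ ⊢ d ⇒ χ) (sym (instance-embed v x α c)) (h c)))

  value-∃ : ∀ x α v → value (∃' x α) v ≋ ⋁ (λ c → value α (v [ x ≔ c ]))
  value-∃ x α v = ↓-lub _ _ (witness-⊢ v x α)
    (λ d h → ∃-⇒-param d x _ (λ c → subst (λ χ → Γ⁺ ⊢ χ ⇒ d) (sym (instance-embed v x α c)) (h c)))

  value-subst : ∀ α x t v → FreeFor t x α → value (α [ x / t ]) v ≋ value α (v [ x ≔ evalT v t ])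
  value-subst α x t v ff = ↓-cong (trans (embed-subst α (asSubst v) x t ff) (embed-cong α _ _ agree))
    where
    agree : ∀ w → (asSubst v [ x ↦ embedT (asSubst v) t ]) w ≡ asSubst (v [ x ≔ evalT v t ]) w
    agree w with w == x
    ... | true  = sym (⌜evalT⌝ v t)
    ... | false = refl

  canonical : ThetaStructure {Θ} (lsuc lzero) (lsuc lzero) lzero
  canonical = record
    { n4 = completionN4
    ; S = ClosedTerm
    ; S-nonempty = param 0
    ; PS = λ P cs → ↓ (atom P ⌜ cs ⌝s)
    ; fS = λ f → capp (inj₁ f)
    ; ‖_‖ = value
    ; ‖‖-ext = λ φ v w h → ↓-cong (embed-cong φ _ _ (λ z → cong ⌜_⌝ (h z)))
    ; ‖atom‖ = λ P ts v → ↓-cong (cong (atom P) (sym (⌜evalTs⌝ v ts)))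
    ; ‖∧‖ = λ α β v → ↓-∧ _ _
    ; ‖∨‖ = λ α β v → ↓-∨ _ _
    ; ‖⇒‖ = λ α β v → ↓-⇒ _ _
    ; ‖¬‖ = λ α v → lift tt
    ; ‖¬¬‖ = λ α v → ↓-⇔' (N12 _)
    ; ‖¬∨‖ = λ α β v → ≋-trans (↓-⇔' (N11 _ _)) (↓-∧ _ _)
    ; ‖¬∧‖ = λ α β v → ≋-trans (↓-⇔' (N10 _ _)) (↓-∨ _ _)
    ; ‖¬⇒‖ = λ α β v → ≋-trans (↓-⇔' (N9 _ _)) (↓-∧ _ _)
    ; ‖∀‖ = value-∀
    ; ‖∃‖ = value-∃
    ; ‖subst‖ = value-subst
    }

-- Completeness

module Completeness {Θ : Signature} (Γ : Fm Θ → Set) where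
  open Parameters Θ
  open CanonicalModel Γ

  prefix : ℕ → Subst → Subst
  prefix zero    ρ = var
  prefix (suc n) ρ = prefix n ρ [ n ↦ ρ n ]

  prefix-cases : ∀ n ρ w → (prefix n ρ w ≡ ρ w) ⊎ (prefix n ρ w ≡ var w)
  prefix-cases zero    ρ w = inj₂ refl
  prefix-cases (suc n) ρ w with w == n in e
  ... | true  = inj₁ (cong ρ (sym (==⇒≡ e)))
  ... | false = prefix-cases n ρ w

  prefix-below : ∀ n ρ w → w < n → prefix n ρ w ≡ ρ w
  prefix-below (suc n) ρ w w<1+n with w == n in e
  ... | true  = cong ρ (sym (==⇒≡ e))
  ... | false = [ prefix-below n ρ w , ⊥-elim ∘ ==-false⇒≢ e ]′ (m<1+n⇒m<n∨m≡n w<1+n)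

  module _ (v : Valuation) where
    private
      ρ : Subst
      ρ = asSubst v

    prefix-varOnlyAt : ∀ n → VarOnlyAt n (prefix n ρ)
    prefix-varOnlyAt n w e with prefix-cases n ρ w
    ... | inj₁ eq rewrite eq = ⌜⌝-closed (v w) n
    ... | inj₂ eq rewrite eq = trans (==-sym n w) e

    prefix-step : ∀ n w → substT (ρ n) n (prefix n ρ w) ≡ prefix (suc n) ρ w
    prefix-step n w with w == n in e
    ... | true rewrite ==⇒≡ e with prefix-cases n ρ n
    ...   | inj₁ eq rewrite eq = substT-notOcc (ρ n) (ρ n) (⌜⌝-closed (v n) n)
    ...   | inj₂ eq rewrite eq | ==-refl n = refl
    prefix-step n w | false with prefix-cases n ρ w
    ...   | inj₁ eq rewrite eq = substT-notOcc (ρ w) (ρ n) (⌜⌝-closed (v w) n)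
    ...   | inj₂ eq rewrite eq | ==-sym n w | e = refl

    hyp-prefix : ∀ γ → Γ γ → ∀ n → Γ⁺ ⊢ embed (prefix n ρ) γ
    hyp-prefix γ g zero    = hyp (γ , g , refl)
    hyp-prefix γ g (suc n) =
      subst (Γ⁺ ⊢_) (trans (subst-embed γ (prefix n ρ) n (ρ n) (prefix-varOnlyAt n) (⌜⌝-closed (v n)))
                           (embed-cong γ _ _ (prefix-step n)))
        (instantiate n (ρ n) (⌜⌝-closed (v n)) (hyp-prefix γ g n))

    hyp-instance : ∀ γ → Γ γ → Γ⁺ ⊢ embed ρ γ
    hyp-instance γ g =
      subst (Γ⁺ ⊢_) (embed-congFree γ _ _ (λ w fw → prefix-below _ ρ w (free⇒<suc-maxVar γ w fw)))
        (hyp-prefix γ g (suc (maxVar γ)))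

  canonical-⊨Γ : ∀ γ → Γ γ → canonical ⊨ₛ γ
  canonical-⊨Γ γ g v = mk⊑ (λ c m → tt) , mk⊑ (λ c _ → ⇒-const c (hyp-instance v γ g))

  hyp-paramsToVar : ∀ z ψ → Γ⁺ ψ → Γ (ParamsToVar.tr z ψ)
  hyp-paramsToVar z ψ (γ , g , refl) = subst Γ (sym (tr-embed-inverse z var γ (λ w → refl))) g

  unembed : ∀ φ → Γ⁺ ⊢ embed var φ → Γ ⊢ φ
  unembed φ d = subst (Γ ⊢_) (tr-embed-inverse z var φ (λ w → refl))
                  (ParamsToVar.tr-⊢ z (hyp-paramsToVar z) d (n<1+n _))
    where z = suc (maxBinder d)

  completeness : ∀ {φ} → Γ ⊨ φ → Γ ⊢ φ
  completeness {φ} H = inst-∀-closure N φ (unembed (∀-closure N φ) (subst (Γ⁺ ⊢_) closed-embed ⊢closure))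
    where
    N = suc (maxVar φ)
    v₀ : Valuation
    v₀ _ = param 0
    ⊢closure : Γ⁺ ⊢ embed (asSubst v₀) (∀-closure N φ)
    ⊢closure = ↓≋𝟏⇒⊢ _ (Soundness.⊨ₛ-∀-closure canonical N φ (H canonical canonical-⊨Γ) v₀)
    closed-embed : embed (asSubst v₀) (∀-closure N φ) ≡ embed var (∀-closure N φ)
    closed-embed = embed-congFree _ _ _ λ w fw →
      ⊥-elim (proj₁ (free-∀-closure N φ w fw) (free⇒<suc-maxVar φ w (proj₂ (free-∀-closure N φ w fw))))

mainTheorem3 : (Θ : Signature) (Γ : Fm Θ → Set) (φ : Fm Θ) → (Γ ⊢ φ) ⇔ (Γ ⊨ φ)
mainTheorem3 Θ Γ φ = mk⇔ soundness (Completeness.completeness Γ)
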